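{- Let $a\in\mathbb{R}\setminus\{0\}$ and $r,t\in\mathbb{N}$. Let $(x^{(r,t)}_n)_{n\ge1}$ be the solution of $$x^{(r,t)}_n=a\,x^{(r,t)}_{\lceil n/2\rceil}+a\,x^{(r,t)}_{\lfloor n/2\rfloor}+\lceil n/2\rceil^r\lfloor n/2\rfloor^t,\qquad n\ge2,$$ with $x^{(r,t)}_1=0$, and let $y^{(r,t)}_n=x^{(r,t)}_n-x^{(r,t)}_{n-1}$ for $n\ge2$. Then for every $n\ge2$, writing $q=q_{s_{n-1}}(n-1)$, $$\begin{aligned} y^{(r,t)}_n&=a^{q}+\sum_{0\le l\le r-1,\ l\neq\ell}\frac{\binom{r}{l}}{2^{t+l}-a}\big((n-1)^{t+l}-a^{q}\big)\\ &\quad+\sum_{i=0}^{r+t-1}\Bigg(2^{ -i}\binom{r+t}{i}-2^{ -i+1}\binom{r}{i-t}-\sum_{l}\frac{\binom{r}{l}\binom{t+l}{i}}{2^{t+l}-a}\Bigg)S^{(0,i)}_{n-1}\\ &\quad+\delta_\ell\cdot\frac1a\binom{r}{\ell}\sum_{j=0}^{s_{n-1}-1}M_{j+1}(n-1)^{t+\ell}\big(q_{j+1}(n-1)-q_j(n-1)\big), \end{aligned}$$ where the inner sum over $l$ runs over integers $l$ with $\max\{0,i-t+1\}\le l\le r-1$ and $l\neq\ell$, and the last line is present only when $\delta_\ell=1$.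
   Context: For $n\in\mathbb{N}_{\ge1}$ write $n=\sum_{j=1}^{s_n}2^{q_j(n)}$ with $0\le q_1(n)<\cdots<q_{s_n}(n)$ (binary decomposition); $q_0(n)=0$; $M_i(n)=\sum_{j=i}^{s_n}2^{q_j(n)}$ for $1\le i\le s_n$. Convention $0^0=1$. Binomial coefficients $\binom{r}{j}$ with $j<0$ or $j>r$ are $0$. For $d,m\in\mathbb{N}$ and $n\ge1$, $S^{(d,m)}_n=\sum_{j=1}^{s_n-1}q_j(n)^d(2^{ -m}a)^{q_j(n)}M_{j+1}(n)^m$. When $a>0$, $\ell=\log_2(a)-t$; when $a\le0$, $\ell$ is undefined and the exclusion $l\neq\ell$ is void. $\delta_\ell=1$ if $a>0$, $r>0$ and $\ell\in\{0,\dots,r-1\}$, and $\delta_\ell=0$ otherwise. -}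

module Defs where

open import Level using (0ℓ)
open import Data.Nat as ℕ using (ℕ; zero; suc; _∸_; ⌊_/2⌋; _<ᵇ_)
open import Data.Nat.Combinatorics using (_C_)
open import Data.Bool using (if_then_else_)
open import Data.List using (List; []; _∷_; length; drop; map)
open import Data.Nat.ListAction using (sum)
open import Data.Product using (Σ; ∃; _×_; _,_)
open import Data.Sum using (_⊎_)
open import Relation.Nullary using (Dec; yes; no; does; ¬_)
open import Relation.Binary.PropositionalEquality using (_≡_; _≢_)
open import Relation.Binary.Structures using (IsStrictTotalOrder)
open import Algebra.Structures using (IsCommutativeRing)

-- positions of the 1-bits of n (shifted by k), in increasing order;
-- the fuel argument is taken to be n itself, which suffices.
bitsFrom : (fuel k n : ℕ) → List ℕ
bitsFrom zero    k n = []
bitsFrom (suc f) k n with n ℕ.% 2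
... | 1 = k ∷ bitsFrom f (suc k) ⌊ n /2⌋
... | _ = bitsFrom f (suc k) ⌊ n /2⌋

-- [q_1(n), ..., q_{s_n}(n)]  with  q_1 < ... < q_{s_n},  n = Σ 2^{q_j}
bits : ℕ → List ℕ
bits n = bitsFrom n 0 n

s : ℕ → ℕ
s n = length (bits n)

at : List ℕ → ℕ → ℕ
at []       _       = 0
at (x ∷ xs) zero    = x
at (x ∷ xs) (suc i) = at xs i

-- q_j(n) for 1 ≤ j ≤ s_n, with the convention q_0(n) = 0
q : ℕ → ℕ → ℕ
q zero    n = 0
q (suc j) n = at (bits n) j

-- M_i(n) = Σ_{j=i}^{s_n} 2^{q_j(n)}   (for 1 ≤ i ≤ s_n)
M : ℕ → ℕ → ℕ
M i n = sum (map (2 ℕ.^_) (drop (i ∸ 1) (bits n)))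

-- The real numbers, axiomatised as a complete ordered field
-- (any two models are isomorphic, so quantifying over all models is
-- the same as speaking about ℝ).

record RealField : Set₁ where
  infixl 6 _+_ _-_
  infixl 7 _*_
  infix  4 _<_ _≤_
  field
    R    : Set
    _+_  : R → R → R
    _*_  : R → R → R
    -_   : R → R
    0#   : R
    1#   : R
    inv  : R → R          -- multiplicative inverse (value at 0# irrelevant)
    _<_  : R → R → Set
    isCommutativeRing  : IsCommutativeRing _≡_ _+_ _*_ -_ 0# 1#
    0≢1                : 0# ≢ 1#
    inv-inverse        : ∀ x → x ≢ 0# → x * inv x ≡ 1#
    isStrictTotalOrder : IsStrictTotalOrder _≡_ _<_
    +-mono-<           : ∀ x y z → x < y → x + z < y + z
    *-pos              : ∀ x y → 0# < x → 0# < y → 0# < x * y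

  _-_ : R → R → R
  x - y = x + (- y)

  _≤_ : R → R → Set
  x ≤ y = x < y ⊎ x ≡ y

  field
    complete : (P : R → Set) → ∃ P → (∃ λ b → ∀ x → P x → x ≤ b) →
               ∃ λ u → (∀ x → P x → x ≤ u) ×
                       (∀ b → (∀ x → P x → x ≤ b) → u ≤ b)

  _≟_ : (x y : R) → Dec (x ≡ y)
  _≟_ = IsStrictTotalOrder._≟_ isStrictTotalOrder

module Paper (F : RealField) where
  open RealField F

  fromℕ : ℕ → R
  fromℕ zero    = 0#
  fromℕ (suc n) = 1# + fromℕ n

  -- natural powers (so 0^0 = 1)
  _^_ : R → ℕ → R
  x ^ zero  = 1#
  x ^ suc n = x * (x ^ n)

  sumR : ℕ → (ℕ → R) → R
  sumR zero    f = 0#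
  sumR (suc m) f = sumR m f + f m

  sumFromTo : ℕ → ℕ → (ℕ → R) → R
  sumFromTo lo hi f = sumR (suc hi ∸ lo) (λ k → f (lo ℕ.+ k))

  twoInv^ : ℕ → R
  twoInv^ m = inv (fromℕ (2 ℕ.^ m))

  S : R → ℕ → ℕ → ℕ → R
  S a d m n = sumFromTo 1 (s n ∸ 1) λ j →
    (fromℕ (q j n) ^ d) * (((twoInv^ m) * a) ^ q j n) * (fromℕ (M (suc j) n) ^ m)

  -- binom(r, i - t) as an integer-index binomial (0 when i - t < 0)
  binomShift : ℕ → ℕ → ℕ → ℕ
  binomShift r i t = if i <ᵇ t then 0 else r C (i ∸ t)

  -- "l = ℓ" where ℓ = log₂ a - t (for a > 0): equivalently a = 2^{t+l}
  IsEll : R → ℕ → ℕ → Set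
  IsEll a t l = fromℕ (2 ℕ.^ (t ℕ.+ l)) ≡ a

  isEll? : (a : R) (t l : ℕ) → Dec (IsEll a t l)
  isEll? a t l = fromℕ (2 ℕ.^ (t ℕ.+ l)) ≟ a

  unlessEll : R → ℕ → ℕ → R → R
  unlessEll a t l v = if does (isEll? a t l) then 0# else v

  findEll : R → ℕ → ℕ → (ℕ → R) → R
  findEll a t zero    g = 0#
  findEll a t (suc k) g with isEll? a t k
  ... | yes _ = g k
  ... | no  _ = findEll a t k g

  -- δ_ℓ · (1/a) binom(r,ℓ) Σ_{j=0}^{s_{m}-1} M_{j+1}(m)^{t+ℓ} (q_{j+1}(m) - q_j(m))
  -- (0 unless δ_ℓ = 1, i.e. a = 2^{t+ℓ} for some ℓ ∈ {0,…,r-1})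
  deltaTerm : R → ℕ → ℕ → ℕ → R
  deltaTerm a r t m = findEll a t r λ ℓ →
    inv a * fromℕ (r C ℓ) *
      sumR (s m) (λ j → (fromℕ (M (suc j) m) ^ (t ℕ.+ ℓ)) *
                         fromℕ (q (suc j) m ∸ q j m))

  -- right-hand side of the formula for y_n, written with m = n - 1
  RHS : R → ℕ → ℕ → ℕ → R
  RHS a r t m =
      (a ^ qq)
    + sumFromTo 0 (r ∸ 1) (λ l → if r ℕ.≡ᵇ 0 then 0# else unlessEll a t l
        (fromℕ (r C l) * inv (fromℕ (2 ℕ.^ (t ℕ.+ l)) - a)
          * ((fromℕ m ^ (t ℕ.+ l)) - (a ^ qq))))
    + sumFromTo 0 (r ℕ.+ t ∸ 1) (λ i → if r ℕ.+ t ℕ.≡ᵇ 0 then 0# else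
        ( (twoInv^ i * fromℕ ((r ℕ.+ t) C i))
        - (twoInv^ i * fromℕ 2 * fromℕ (binomShift r i t))
        - sumFromTo (suc i ∸ t) (r ∸ 1) (λ l → if r ℕ.≡ᵇ 0 then 0# else unlessEll a t l
            (fromℕ (r C l) * fromℕ ((t ℕ.+ l) C i)
              * inv (fromℕ (2 ℕ.^ (t ℕ.+ l)) - a))))
        * S a 0 i m)
    + deltaTerm a r t m
    where
      qq : ℕ
      qq = q (s m) m

-- Write y m = x (m + 1) - x m. Subtracting the recursion at consecutive arguments gives y 1 = 1 and,
-- for k ≥ 1,
--   y (2k)     = a y k + (k+1)^r k^t - k^r k^t,
--   y (2k + 1) = a y k + (k+1)^r (k+1)^t - (k+1)^r k^t,
-- which determine y on m ≥ 1 by induction on the binary length of m. So it suffices to show that the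
-- right-hand side satisfies the same equations. The binary digits of 2k are those of k shifted up by
-- one, and 2k + 1 has an extra digit 0 in front; hence a^q and each S^(0,i) scale by a, and the δ-sum
-- by 2^(t+ℓ) = a, up to the contribution of the new digit. What is left over is a polynomial in k,
-- which the binomial theorem identifies with the inhomogeneous term.

module Submission where

open import Defs
open import Level using (0ℓ)
open import Function using (_∘_)
open import Data.Empty using (⊥-elim)
open import Data.Bool using (true; false; if_then_else_)
open import Data.Sum using (inj₁; inj₂)
open import Data.List using (List; []; _∷_; map; length; drop)
open import Data.Nat.ListAction using (sum)
open import Data.Nat as Nat using (ℕ; zero; suc; z≤n; s≤s; z<s; NonZero; ⌊_/2⌋; ⌈_/2⌉)
import Data.Nat.Properties as ℕₚ
open import Data.Nat.Induction using (<-rec)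
open import Data.Nat.Combinatorics using (_C_; nCn≡1; k>n⇒nCk≡0; nCk+nC[k+1]≡[n+1]C[k+1])
open import Data.Integer as ℤ using (ℤ; -[1+_])
import Data.Integer.Properties as ℤₚ
open import Data.Sign as Sign using (Sign)
open import Data.Maybe using (Maybe; just; nothing)
open import Algebra.Bundles using (CommutativeRing)
open import Algebra.Solver.Ring.AlmostCommutativeRing
  using (fromCommutativeRing; _-Raw-AlmostCommutative⟶_)
import Algebra.Solver.Ring
open import Relation.Nullary using (¬_; yes; no)
open import Relation.Binary.Structures using (IsStrictTotalOrder)
open import Relation.Binary.Definitions using (tri<; tri≈; tri>)
open import Function.Bundles using (Equivalence)
open import Data.Bool.Properties using (T-≡)
open import Relation.Binary.PropositionalEquality
open ≡-Reasoning

-- Binary digits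

module _ where
  open Nat using (_+_; _*_; _^_; _∸_; _≤_; _<_; _≤ᵇ_; _%_)
  open ℕₚ

  data Parity : ℕ → Set where
    even : ∀ k → Parity (k + k)
    odd  : ∀ k → Parity (suc (k + k))

  parity : ∀ n → Parity n
  parity zero = even 0
  parity (suc n) with parity n
  ... | even k = odd k
  ... | odd k  = subst Parity (cong suc (+-suc k k)) (even (suc k))

  binary-induction : (P : ℕ → Set) → P 0 →
                     (∀ k → P k → P (k + k)) → (∀ k → P k → P (suc (k + k))) →
                     ∀ n → P n
  binary-induction P p₀ p-even p-odd = <-rec P step
    where
    step : ∀ n → (∀ {m} → m < n → P m) → P n
    step n ih with parity n
    ... | even zero    = p₀
    ... | even (suc k) = p-even (suc k) (ih (m<m+n (suc k) z<s))
    ... | odd k        = p-odd k (ih (s≤s (m≤m+n k k)))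

  value : List ℕ → ℕ
  value L = sum (map (2 ^_) L)

  value-map-suc : ∀ L → value (map suc L) ≡ 2 * value L
  value-map-suc []      = refl
  value-map-suc (x ∷ L) = begin
    2 * 2 ^ x + value (map suc L) ≡⟨ cong (2 * 2 ^ x +_) (value-map-suc L) ⟩
    2 * 2 ^ x + 2 * value L       ≡⟨ *-distribˡ-+ 2 (2 ^ x) (value L) ⟨
    2 * value (x ∷ L)             ∎

  bitsFrom-0 : ∀ f k → bitsFrom f k 0 ≡ []
  bitsFrom-0 zero    k = refl
  bitsFrom-0 (suc f) k = bitsFrom-0 f (suc k)

  n≤1+f⇒⌊n/2⌋≤f : ∀ n f → n ≤ suc f → ⌊ n /2⌋ ≤ f
  n≤1+f⇒⌊n/2⌋≤f zero    f _  = z≤n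
  n≤1+f⇒⌊n/2⌋≤f (suc n) f le = ≤-pred (≤-trans (⌊n/2⌋<n n) le)

  bitsFrom-fuel : ∀ f g k n → n ≤ f → n ≤ g → bitsFrom f k n ≡ bitsFrom g k n
  bitsFrom-fuel zero    zero    k n       _   _   = refl
  bitsFrom-fuel zero    (suc g) k .0      z≤n _   = sym (bitsFrom-0 (suc g) k)
  bitsFrom-fuel (suc f) zero    k .0      _   z≤n = bitsFrom-0 (suc f) k
  bitsFrom-fuel (suc f) (suc g) k n n≤f n≤g
    with n % 2 | bitsFrom-fuel f g (suc k) ⌊ n /2⌋ (n≤1+f⇒⌊n/2⌋≤f n f n≤f) (n≤1+f⇒⌊n/2⌋≤f n g n≤g)
  ... | 0           | same-tail = same-tail
  ... | 1           | same-tail = cong (k ∷_) same-tail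
  ... | suc (suc _) | same-tail = same-tail

  bitsFrom-shift : ∀ f k n → bitsFrom f (suc k) n ≡ map suc (bitsFrom f k n)
  bitsFrom-shift zero    k n = refl
  bitsFrom-shift (suc f) k n with n % 2
  ... | 0           = bitsFrom-shift f (suc k) ⌊ n /2⌋
  ... | 1           = cong (suc k ∷_) (bitsFrom-shift f (suc k) ⌊ n /2⌋)
  ... | suc (suc _) = bitsFrom-shift f (suc k) ⌊ n /2⌋

  double%2≡0 : ∀ k → (k + k) % 2 ≡ 0
  double%2≡0 zero = refl
  double%2≡0 (suc k) rewrite +-suc k k = double%2≡0 k

  double+1%2≡1 : ∀ k → suc (k + k) % 2 ≡ 1
  double+1%2≡1 zero = refl
  double+1%2≡1 (suc k) rewrite +-suc k k = double+1%2≡1 k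

  bitsFrom-even : ∀ f k n → n % 2 ≡ 0 → bitsFrom (suc f) k n ≡ bitsFrom f (suc k) ⌊ n /2⌋
  bitsFrom-even f k n n%2≡0 rewrite n%2≡0 = refl

  bitsFrom-odd : ∀ f k n → n % 2 ≡ 1 → bitsFrom (suc f) k n ≡ k ∷ bitsFrom f (suc k) ⌊ n /2⌋
  bitsFrom-odd f k n n%2≡1 rewrite n%2≡1 = refl

  bits-double : ∀ k → bits (k + k) ≡ map suc (bits k)
  bits-double zero    = refl
  bits-double (suc k) = begin
    bitsFrom (suc (k + suc k)) 0 (suc k + suc k)
      ≡⟨ bitsFrom-even (k + suc k) 0 (suc k + suc k) (double%2≡0 (suc k)) ⟩
    bitsFrom (k + suc k) 1 ⌊ suc k + suc k /2⌋
      ≡⟨ cong (bitsFrom (k + suc k) 1) (n≡⌊n+n/2⌋ (suc k)) ⟨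
    bitsFrom (k + suc k) 1 (suc k)
      ≡⟨ bitsFrom-shift (k + suc k) 0 (suc k) ⟩
    map suc (bitsFrom (k + suc k) 0 (suc k))
      ≡⟨ cong (map suc) (bitsFrom-fuel (k + suc k) (suc k) 0 (suc k) (m≤n+m (suc k) k) ≤-refl) ⟩
    map suc (bits (suc k)) ∎

  bits-double+1 : ∀ k → bits (suc (k + k)) ≡ 0 ∷ map suc (bits k)
  bits-double+1 k = begin
    bitsFrom (suc (k + k)) 0 (suc (k + k))
      ≡⟨ bitsFrom-odd (k + k) 0 (suc (k + k)) (double+1%2≡1 k) ⟩
    0 ∷ bitsFrom (k + k) 1 ⌊ suc (k + k) /2⌋
      ≡⟨ cong (λ n → 0 ∷ bitsFrom (k + k) 1 n) (n≡⌈n+n/2⌉ k) ⟨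
    0 ∷ bitsFrom (k + k) 1 k
      ≡⟨ cong (0 ∷_) (bitsFrom-shift (k + k) 0 k) ⟩
    0 ∷ map suc (bitsFrom (k + k) 0 k)
      ≡⟨ cong (λ L → 0 ∷ map suc L) (bitsFrom-fuel (k + k) k 0 k (m≤n+m k k) ≤-refl) ⟩
    0 ∷ map suc (bits k) ∎

  value-bits : ∀ n → value (bits n) ≡ n
  value-bits = binary-induction (λ n → value (bits n) ≡ n) refl double double+1
    where
    double : ∀ k → value (bits k) ≡ k → value (bits (k + k)) ≡ k + k
    double k ih = begin
      value (bits (k + k))      ≡⟨ cong value (bits-double k) ⟩
      value (map suc (bits k))  ≡⟨ value-map-suc (bits k) ⟩
      2 * value (bits k)        ≡⟨ cong (2 *_) ih ⟩
      2 * k                     ≡⟨ cong (k +_) (+-identityʳ k) ⟩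
      k + k                     ∎
    double+1 : ∀ k → value (bits k) ≡ k → value (bits (suc (k + k))) ≡ suc (k + k)
    double+1 k ih = begin
      value (bits (suc (k + k)))      ≡⟨ cong value (bits-double+1 k) ⟩
      suc (value (map suc (bits k)))  ≡⟨ cong (suc ∘ value) (bits-double k) ⟨
      suc (value (bits (k + k)))      ≡⟨ cong suc (double k ih) ⟩
      suc (k + k)                     ∎

  bits-nonempty : ∀ k .{{_ : NonZero k}} → bits k ≢ []
  bits-nonempty (suc k) bits≡[] = 1+n≢0 (trans (sym (value-bits (suc k))) (cong value bits≡[]))

  double≢0 : ∀ k .{{_ : NonZero k}} → NonZero (k + k)
  double≢0 (suc k) = _

  2≤double : ∀ k .{{_ : NonZero k}} → 2 ≤ k + k
  2≤double (suc k) = s≤s (≤-trans (s≤s z≤n) (m≤n+m (suc k) k))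

  lastDigit : List ℕ → ℕ
  lastDigit []          = 0
  lastDigit (x ∷ [])    = x
  lastDigit (x ∷ y ∷ L) = lastDigit (y ∷ L)

  lastDigit-map-suc : ∀ L → L ≢ [] → lastDigit (map suc L) ≡ suc (lastDigit L)
  lastDigit-map-suc []          L≢[] = ⊥-elim (L≢[] refl)
  lastDigit-map-suc (x ∷ [])    _    = refl
  lastDigit-map-suc (x ∷ y ∷ L) _    = lastDigit-map-suc (y ∷ L) (λ ())

  lastDigit-0∷map-suc : ∀ L → L ≢ [] → lastDigit (0 ∷ map suc L) ≡ suc (lastDigit L)
  lastDigit-0∷map-suc []      L≢[] = ⊥-elim (L≢[] refl)
  lastDigit-0∷map-suc (x ∷ L) _    = lastDigit-map-suc (x ∷ L) (λ ())

  topDigit : ℕ → ℕ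
  topDigit m = q (s m) m

  topDigit≡lastDigit : ∀ m → topDigit m ≡ lastDigit (bits m)
  topDigit≡lastDigit m = go (bits m) refl
    where
    at-length : ∀ x L → at (x ∷ L) (length L) ≡ lastDigit (x ∷ L)
    at-length x []      = refl
    at-length x (y ∷ L) = at-length y L
    go : ∀ L → bits m ≡ L → q (length L) m ≡ lastDigit L
    go []      _  = refl
    go (x ∷ L) eq = trans (cong (λ L′ → at L′ (length L)) eq) (at-length x L)

  topDigit-double : ∀ k .{{_ : NonZero k}} → topDigit (k + k) ≡ suc (topDigit k)
  topDigit-double k = begin
    topDigit (k + k)                ≡⟨ topDigit≡lastDigit (k + k) ⟩
    lastDigit (bits (k + k))        ≡⟨ cong lastDigit (bits-double k) ⟩
    lastDigit (map suc (bits k))    ≡⟨ lastDigit-map-suc (bits k) (bits-nonempty k) ⟩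
    suc (lastDigit (bits k))        ≡⟨ cong suc (topDigit≡lastDigit k) ⟨
    suc (topDigit k)                ∎

  topDigit-double+1 : ∀ k .{{_ : NonZero k}} → topDigit (suc (k + k)) ≡ suc (topDigit k)
  topDigit-double+1 k = begin
    topDigit (suc (k + k))              ≡⟨ topDigit≡lastDigit (suc (k + k)) ⟩
    lastDigit (bits (suc (k + k)))      ≡⟨ cong lastDigit (bits-double+1 k) ⟩
    lastDigit (0 ∷ map suc (bits k))    ≡⟨ lastDigit-0∷map-suc (bits k) (bits-nonempty k) ⟩
    suc (lastDigit (bits k))            ≡⟨ cong suc (topDigit≡lastDigit k) ⟨
    suc (topDigit k)                    ∎

  2^-injective : ∀ {m n} → 2 ^ m ≡ 2 ^ n → m ≡ n
  2^-injective {m} {n} 2^m≡2^n with <-cmp m n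
  ... | tri< m<n _ _ = ⊥-elim (<-irrefl 2^m≡2^n (^-monoʳ-< 2 ≤-refl m<n))
  ... | tri≈ _ m≡n _ = m≡n
  ... | tri> _ _ n<m = ⊥-elim (<-irrefl (sym 2^m≡2^n) (^-monoʳ-< 2 ≤-refl n<m))

  ≤ᵇ-true : ∀ {m n} → m ≤ n → (m ≤ᵇ n) ≡ true
  ≤ᵇ-true m≤n = Equivalence.to T-≡ (≤⇒≤ᵇ m≤n)

  ≤ᵇ-false : ∀ {m n} → n < m → (m ≤ᵇ n) ≡ false
  ≤ᵇ-false {m} {n} n<m with m ≤ᵇ n | ≤ᵇ⇒≤ m n
  ... | false | _   = refl
  ... | true  | m≤n = ⊥-elim (<⇒≱ n<m (m≤n _))

  ∸-≤ᵇ : ∀ m n o → (m ∸ n ≤ᵇ o) ≡ (m ≤ᵇ n + o)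
  ∸-≤ᵇ m       zero    o = refl
  ∸-≤ᵇ zero    (suc n) o = refl
  ∸-≤ᵇ (suc m) (suc n) o = trans (∸-≤ᵇ m n o) (≤ᵇ-suc m (n + o))
    where
    ≤ᵇ-suc : ∀ m k → (m ≤ᵇ k) ≡ (suc m ≤ᵇ suc k)
    ≤ᵇ-suc zero    k = refl
    ≤ᵇ-suc (suc m) k = refl

module Reals (F : RealField) where
  open RealField F
  open Paper F

  commutativeRing : CommutativeRing 0ℓ 0ℓ
  commutativeRing = record { isCommutativeRing = isCommutativeRing }

  open CommutativeRing commutativeRing
    using (+-comm; +-assoc; *-comm; *-assoc; +-identityˡ; +-identityʳ; *-identityˡ; *-identityʳ;
           distribˡ; distribʳ; zeroˡ; zeroʳ; -‿inverseʳ; ring; +-abelianGroup)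
  open import Algebra.Properties.Ring ring using (-‿distribˡ-*; -‿distribʳ-*; -0#≈0#)
  open import Algebra.Properties.AbelianGroup +-abelianGroup using (⁻¹-∙-comm; ⁻¹-involutive)

  fromℕ-+ : ∀ m n → fromℕ (m Nat.+ n) ≡ fromℕ m + fromℕ n
  fromℕ-+ zero    n = sym (+-identityˡ _)
  fromℕ-+ (suc m) n = trans (cong (1# +_) (fromℕ-+ m n)) (sym (+-assoc _ _ _))

  fromℕ-* : ∀ m n → fromℕ (m Nat.* n) ≡ fromℕ m * fromℕ n
  fromℕ-* zero    n = sym (zeroˡ _)
  fromℕ-* (suc m) n = begin
    fromℕ (n Nat.+ m Nat.* n)       ≡⟨ fromℕ-+ n (m Nat.* n) ⟩
    fromℕ n + fromℕ (m Nat.* n)     ≡⟨ cong₂ _+_ (sym (*-identityˡ _)) (fromℕ-* m n) ⟩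
    1# * fromℕ n + fromℕ m * fromℕ n ≡⟨ distribʳ _ _ _ ⟨
    fromℕ (suc m) * fromℕ n          ∎

  fromℕ-1 : fromℕ 1 ≡ 1#
  fromℕ-1 = +-identityʳ 1#

  fromℤ : ℤ → R
  fromℤ (ℤ.+ n)  = fromℕ n
  fromℤ -[1+ n ] = - fromℕ (suc n)

  fromℤ-⊖ : ∀ m n → fromℤ (m ℤ.⊖ n) ≡ fromℕ m - fromℕ n
  fromℤ-⊖ zero    zero    = sym (trans (cong (0# +_) -0#≈0#) (+-identityʳ 0#))
  fromℤ-⊖ zero    (suc n) = sym (+-identityˡ _)
  fromℤ-⊖ (suc m) zero    = sym (trans (cong (fromℕ (suc m) +_) -0#≈0#) (+-identityʳ _))
  fromℤ-⊖ (suc m) (suc n) = begin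
    fromℤ (suc m ℤ.⊖ suc n)           ≡⟨ cong fromℤ (ℤₚ.[1+m]⊖[1+n]≡m⊖n m n) ⟩
    fromℤ (m ℤ.⊖ n)                   ≡⟨ fromℤ-⊖ m n ⟩
    fromℕ m - fromℕ n                 ≡⟨ cancel-1 (fromℕ m) (fromℕ n) ⟨
    (1# + fromℕ m) - (1# + fromℕ n)   ∎
    where
    cancel-1 : ∀ x y → (1# + x) - (1# + y) ≡ x - y
    cancel-1 x y = begin
      (1# + x) + - (1# + y)     ≡⟨ cong ((1# + x) +_) (⁻¹-∙-comm 1# y) ⟨
      (1# + x) + (- 1# + - y)   ≡⟨ +-assoc 1# x _ ⟩
      1# + (x + (- 1# + - y))   ≡⟨ cong (1# +_) (trans (sym (+-assoc x _ _)) (trans (cong (_+ - y) (+-comm x _)) (+-assoc _ _ _))) ⟩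
      1# + (- 1# + (x - y))     ≡⟨ +-assoc _ _ _ ⟨
      (1# + - 1#) + (x - y)     ≡⟨ cong (_+ (x - y)) (-‿inverseʳ 1#) ⟩
      0# + (x - y)              ≡⟨ +-identityˡ _ ⟩
      x - y                     ∎

  fromℤ-+ : ∀ i j → fromℤ (i ℤ.+ j) ≡ fromℤ i + fromℤ j
  fromℤ-+ (ℤ.+ m)  (ℤ.+ n)  = fromℕ-+ m n
  fromℤ-+ (ℤ.+ m)  -[1+ n ] = fromℤ-⊖ m (suc n)
  fromℤ-+ -[1+ m ] (ℤ.+ n)  = trans (fromℤ-⊖ n (suc m)) (+-comm _ _)
  fromℤ-+ -[1+ m ] -[1+ n ] = begin
    - fromℕ (suc (suc (m Nat.+ n)))            ≡⟨ cong (λ k → - fromℕ (suc k)) (ℕₚ.+-suc m n) ⟨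
    - fromℕ (suc m Nat.+ suc n)                ≡⟨ cong -_ (fromℕ-+ (suc m) (suc n)) ⟩
    - (fromℕ (suc m) + fromℕ (suc n))          ≡⟨ ⁻¹-∙-comm _ _ ⟨
    - fromℕ (suc m) + - fromℕ (suc n)          ∎

  fromℤ-neg : ∀ i → fromℤ (ℤ.- i) ≡ - fromℤ i
  fromℤ-neg (ℤ.+ zero)    = sym -0#≈0#
  fromℤ-neg (ℤ.+ (suc n)) = refl
  fromℤ-neg -[1+ n ]      = sym (⁻¹-involutive _)

  signed : Sign → R → R
  signed Sign.+ x = x
  signed Sign.- x = - x

  fromℤ-◃ : ∀ σ n → fromℤ (σ ℤ.◃ n) ≡ signed σ (fromℕ n)
  fromℤ-◃ Sign.+ zero    = refl
  fromℤ-◃ Sign.- zero    = sym -0#≈0#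
  fromℤ-◃ Sign.+ (suc n) = refl
  fromℤ-◃ Sign.- (suc n) = refl

  fromℤ≡signed : ∀ i → fromℤ i ≡ signed (ℤ.sign i) (fromℕ ℤ.∣ i ∣)
  fromℤ≡signed (ℤ.+ zero)    = refl
  fromℤ≡signed (ℤ.+ (suc n)) = refl
  fromℤ≡signed -[1+ n ]      = refl

  signed-* : ∀ σ τ x y → signed (σ Sign.* τ) (x * y) ≡ signed σ x * signed τ y
  signed-* Sign.+ Sign.+ x y = refl
  signed-* Sign.+ Sign.- x y = -‿distribʳ-* x y
  signed-* Sign.- Sign.+ x y = -‿distribˡ-* x y
  signed-* Sign.- Sign.- x y = begin
    x * y           ≡⟨ ⁻¹-involutive _ ⟨
    - - (x * y)     ≡⟨ cong -_ (-‿distribˡ-* x y) ⟩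
    - (- x * y)     ≡⟨ -‿distribʳ-* (- x) y ⟩
    - x * - y       ∎

  fromℤ-* : ∀ i j → fromℤ (i ℤ.* j) ≡ fromℤ i * fromℤ j
  fromℤ-* i j = begin
    fromℤ (i ℤ.* j)
      ≡⟨ fromℤ-◃ (ℤ.sign i Sign.* ℤ.sign j) (ℤ.∣ i ∣ Nat.* ℤ.∣ j ∣) ⟩
    signed (ℤ.sign i Sign.* ℤ.sign j) (fromℕ (ℤ.∣ i ∣ Nat.* ℤ.∣ j ∣))
      ≡⟨ cong (signed (ℤ.sign i Sign.* ℤ.sign j)) (fromℕ-* ℤ.∣ i ∣ ℤ.∣ j ∣) ⟩
    signed (ℤ.sign i Sign.* ℤ.sign j) (fromℕ ℤ.∣ i ∣ * fromℕ ℤ.∣ j ∣)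
      ≡⟨ signed-* (ℤ.sign i) (ℤ.sign j) _ _ ⟩
    signed (ℤ.sign i) (fromℕ ℤ.∣ i ∣) * signed (ℤ.sign j) (fromℕ ℤ.∣ j ∣)
      ≡⟨ cong₂ _*_ (fromℤ≡signed i) (fromℤ≡signed j) ⟨
    fromℤ i * fromℤ j ∎

  -- The solver evaluates a coefficient c to ⟦ c ⟧, which must be 1# itself (not 1# + 0#) for c = 1.
  fromℕ′ : ℕ → R
  fromℕ′ 0             = 0#
  fromℕ′ 1             = 1#
  fromℕ′ (suc (suc n)) = 1# + fromℕ′ (suc n)

  fromℕ′≡fromℕ : ∀ n → fromℕ′ n ≡ fromℕ n
  fromℕ′≡fromℕ 0             = refl
  fromℕ′≡fromℕ 1             = sym fromℕ-1
  fromℕ′≡fromℕ (suc (suc n)) = cong (1# +_) (fromℕ′≡fromℕ (suc n))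

  ⟦_⟧ : ℤ → R
  ⟦ ℤ.+ n ⟧    = fromℕ′ n
  ⟦ -[1+ n ] ⟧ = - fromℕ′ (suc n)

  ⟦⟧≡fromℤ : ∀ i → ⟦ i ⟧ ≡ fromℤ i
  ⟦⟧≡fromℤ (ℤ.+ n)  = fromℕ′≡fromℕ n
  ⟦⟧≡fromℤ -[1+ n ] = cong -_ (fromℕ′≡fromℕ (suc n))

  ⟦⟧-+ : ∀ i j → ⟦ i ℤ.+ j ⟧ ≡ ⟦ i ⟧ + ⟦ j ⟧
  ⟦⟧-+ i j rewrite ⟦⟧≡fromℤ (i ℤ.+ j) | ⟦⟧≡fromℤ i | ⟦⟧≡fromℤ j = fromℤ-+ i j

  ⟦⟧-* : ∀ i j → ⟦ i ℤ.* j ⟧ ≡ ⟦ i ⟧ * ⟦ j ⟧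
  ⟦⟧-* i j rewrite ⟦⟧≡fromℤ (i ℤ.* j) | ⟦⟧≡fromℤ i | ⟦⟧≡fromℤ j = fromℤ-* i j

  ⟦⟧-neg : ∀ i → ⟦ ℤ.- i ⟧ ≡ - ⟦ i ⟧
  ⟦⟧-neg i rewrite ⟦⟧≡fromℤ (ℤ.- i) | ⟦⟧≡fromℤ i = fromℤ-neg i

  homomorphism : ℤ.+-*-rawRing -Raw-AlmostCommutative⟶ fromCommutativeRing commutativeRing
  homomorphism = record
    { ⟦_⟧    = ⟦_⟧
    ; +-homo = ⟦⟧-+
    ; *-homo = ⟦⟧-*
    ; -‿homo = ⟦⟧-neg
    ; 0-homo = refl
    ; 1-homo = refl
    }

  ⟦⟧-≟ : ∀ i j → Maybe (⟦ i ⟧ ≡ ⟦ j ⟧)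
  ⟦⟧-≟ i j with i ℤ.≟ j
  ... | yes i≡j = just (cong ⟦_⟧ i≡j)
  ... | no  _   = nothing

  open Algebra.Solver.Ring ℤ.+-*-rawRing (fromCommutativeRing commutativeRing) homomorphism ⟦⟧-≟

  ^-homo-* : ∀ x m n → x ^ (m Nat.+ n) ≡ x ^ m * x ^ n
  ^-homo-* x zero    n = sym (*-identityˡ _)
  ^-homo-* x (suc m) n = trans (cong (x *_) (^-homo-* x m n)) (sym (*-assoc _ _ _))

  ^-distrib-* : ∀ x y n → (x * y) ^ n ≡ x ^ n * y ^ n
  ^-distrib-* x y zero    = sym (*-identityˡ 1#)
  ^-distrib-* x y (suc n) = trans (cong ((x * y) *_) (^-distrib-* x y n))
    (solve 4 (λ x y u v → (x :* y) :* (u :* v) := (x :* u) :* (y :* v)) refl x y (x ^ n) (y ^ n))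

  1^n≡1 : ∀ n → 1# ^ n ≡ 1#
  1^n≡1 zero    = refl
  1^n≡1 (suc n) = trans (*-identityˡ _) (1^n≡1 n)

  fromℕ-^ : ∀ m n → fromℕ (m Nat.^ n) ≡ fromℕ m ^ n
  fromℕ-^ m zero    = fromℕ-1
  fromℕ-^ m (suc n) = trans (fromℕ-* m (m Nat.^ n)) (cong (fromℕ m *_) (fromℕ-^ m n))

  fromℕ-2 : fromℕ 2 ≡ 1# + 1#
  fromℕ-2 = cong (1# +_) fromℕ-1

  fromℕ-double : ∀ k → fromℕ (k Nat.+ k) ≡ fromℕ 2 * fromℕ k
  fromℕ-double k = trans (cong (λ n → fromℕ (k Nat.+ n)) (sym (ℕₚ.+-identityʳ k))) (fromℕ-* 2 k)

  fromℕ-double^ : ∀ k n → fromℕ (k Nat.+ k) ^ n ≡ fromℕ (2 Nat.^ n) * fromℕ k ^ n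
  fromℕ-double^ k n = begin
    fromℕ (k Nat.+ k) ^ n            ≡⟨ cong (_^ n) (fromℕ-double k) ⟩
    (fromℕ 2 * fromℕ k) ^ n          ≡⟨ ^-distrib-* (fromℕ 2) (fromℕ k) n ⟩
    fromℕ 2 ^ n * fromℕ k ^ n        ≡⟨ cong (_* fromℕ k ^ n) (fromℕ-^ 2 n) ⟨
    fromℕ (2 Nat.^ n) * fromℕ k ^ n  ∎

  module STO = IsStrictTotalOrder isStrictTotalOrder

  0<1 : 0# < 1#
  0<1 with STO.compare 0# 1#
  ... | tri< 0<1 _ _ = 0<1
  ... | tri≈ _ 0≡1 _ = ⊥-elim (0≢1 0≡1)
  ... | tri> _ _ 1<0 = ⊥-elim (STO.irrefl refl (STO.trans 0<[-1]² 1<0))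
    where
    0<-1 : 0# < - 1#
    0<-1 = subst₂ _<_ (-‿inverseʳ 1#) (+-identityˡ _) (+-mono-< 1# 0# (- 1#) 1<0)
    0<[-1]² : 0# < 1#
    0<[-1]² = subst (0# <_) (solve 0 (:- con (ℤ.+ 1) :* :- con (ℤ.+ 1) := con (ℤ.+ 1)) refl) (*-pos _ _ 0<-1 0<-1)

  0<fromℕ-suc : ∀ n → 0# < fromℕ (suc n)
  0<fromℕ-suc zero    = subst (0# <_) (sym fromℕ-1) 0<1
  0<fromℕ-suc (suc n) =
    STO.trans 0<1 (subst₂ _<_ (+-identityˡ 1#) (+-comm _ 1#) (+-mono-< 0# _ 1# (0<fromℕ-suc n)))

  fromℕ≢0 : ∀ n .{{_ : NonZero n}} → fromℕ n ≢ 0#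
  fromℕ≢0 (suc n) fromℕ≡0 = STO.irrefl refl (subst (0# <_) fromℕ≡0 (0<fromℕ-suc n))

  fromℕ-injective : ∀ m n → fromℕ m ≡ fromℕ n → m ≡ n
  fromℕ-injective zero    zero    _  = refl
  fromℕ-injective zero    (suc n) eq = ⊥-elim (fromℕ≢0 (suc n) (sym eq))
  fromℕ-injective (suc m) zero    eq = ⊥-elim (fromℕ≢0 (suc m) eq)
  fromℕ-injective (suc m) (suc n) eq = cong suc (fromℕ-injective m n (cancel-1+ eq))
    where
    cancel-1+ : ∀ {x y} → 1# + x ≡ 1# + y → x ≡ y
    cancel-1+ {x} {y} eq = begin
      x                  ≡⟨ solve 1 (λ x → x := :- con (ℤ.+ 1) :+ (con (ℤ.+ 1) :+ x)) refl x ⟩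
      - 1# + (1# + x)    ≡⟨ cong (- 1# +_) eq ⟩
      - 1# + (1# + y)    ≡⟨ solve 1 (λ y → :- con (ℤ.+ 1) :+ (con (ℤ.+ 1) :+ y) := y) refl y ⟩
      y                  ∎

  inv-inverseˡ : ∀ x → x ≢ 0# → inv x * x ≡ 1#
  inv-inverseˡ x x≢0 = trans (*-comm _ _) (inv-inverse x x≢0)

  x-y≡0⇒x≡y : ∀ {x y} → x - y ≡ 0# → x ≡ y
  x-y≡0⇒x≡y {x} {y} x-y≡0 = begin
    x              ≡⟨ solve 2 (λ x y → x := (x :- y) :+ y) refl x y ⟩
    (x - y) + y    ≡⟨ cong (_+ y) x-y≡0 ⟩
    0# + y         ≡⟨ +-identityˡ y ⟩
    y              ∎

  twoInv^-inverse : ∀ i → twoInv^ i * fromℕ 2 ^ i ≡ 1#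
  twoInv^-inverse i = begin
    twoInv^ i * fromℕ 2 ^ i          ≡⟨ cong (twoInv^ i *_) (fromℕ-^ 2 i) ⟨
    twoInv^ i * fromℕ (2 Nat.^ i)    ≡⟨ inv-inverseˡ _ (fromℕ≢0 (2 Nat.^ i) {{ℕₚ.m^n≢0 2 i}}) ⟩
    1#                               ∎

  -- Finite sums and the binomial theorem

  sumR-cong : ∀ n {f g : ℕ → R} → (∀ k → k Nat.< n → f k ≡ g k) → sumR n f ≡ sumR n g
  sumR-cong zero    _   = refl
  sumR-cong (suc n) f≗g = cong₂ _+_ (sumR-cong n (λ k k<n → f≗g k (ℕₚ.m<n⇒m<1+n k<n))) (f≗g n ℕₚ.≤-refl)

  sumR-zero : ∀ n {f : ℕ → R} → (∀ k → k Nat.< n → f k ≡ 0#) → sumR n f ≡ 0#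
  sumR-zero zero    _    = refl
  sumR-zero (suc n) f≗0 =
    trans (cong₂ _+_ (sumR-zero n (λ k k<n → f≗0 k (ℕₚ.m<n⇒m<1+n k<n))) (f≗0 n ℕₚ.≤-refl)) (+-identityˡ 0#)

  sumR-+ : ∀ n (f g : ℕ → R) → sumR n (λ k → f k + g k) ≡ sumR n f + sumR n g
  sumR-+ zero    f g = sym (+-identityˡ 0#)
  sumR-+ (suc n) f g = trans (cong (_+ (f n + g n)) (sumR-+ n f g))
    (solve 4 (λ a b c d → (a :+ b) :+ (c :+ d) := (a :+ c) :+ (b :+ d)) refl _ _ _ _)

  sumR-*ˡ : ∀ n c (f : ℕ → R) → sumR n (λ k → c * f k) ≡ c * sumR n f
  sumR-*ˡ zero    c f = sym (zeroʳ c)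
  sumR-*ˡ (suc n) c f = trans (cong (_+ c * f n) (sumR-*ˡ n c f)) (sym (distribˡ _ _ _))

  sumR-suc : ∀ n (f : ℕ → R) → sumR (suc n) f ≡ f 0 + sumR n (f ∘ suc)
  sumR-suc zero    f = trans (+-identityˡ _) (sym (+-identityʳ _))
  sumR-suc (suc n) f = trans (cong (_+ f (suc n)) (sumR-suc n f)) (+-assoc _ _ _)

  sumR-split : ∀ m n (f : ℕ → R) → sumR (m Nat.+ n) f ≡ sumR m f + sumR n (λ k → f (m Nat.+ k))
  sumR-split m zero    f = trans (cong (λ k → sumR k f) (ℕₚ.+-identityʳ m)) (sym (+-identityʳ _))
  sumR-split m (suc n) f = trans (cong (λ k → sumR k f) (ℕₚ.+-suc m n))
    (trans (cong (_+ f (m Nat.+ n)) (sumR-split m n f)) (+-assoc _ _ _))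

  sumR-comm : ∀ m n (f : ℕ → ℕ → R) →
              sumR m (λ i → sumR n (f i)) ≡ sumR n (λ j → sumR m (λ i → f i j))
  sumR-comm zero    n f = sym (sumR-zero n (λ _ _ → refl))
  sumR-comm (suc m) n f = trans (cong (_+ sumR n (f m)) (sumR-comm m n f)) (sym (sumR-+ n _ _))

  sumR-neg : ∀ n (f : ℕ → R) → sumR n (λ k → - f k) ≡ - sumR n f
  sumR-neg zero    f = sym -0#≈0#
  sumR-neg (suc n) f = trans (cong (_+ - f n) (sumR-neg n f)) (⁻¹-∙-comm _ _)

  sumR-− : ∀ n (f g : ℕ → R) → sumR n (λ k → f k - g k) ≡ sumR n f - sumR n g
  sumR-− n f g = trans (sumR-+ n f (λ k → - g k)) (cong (sumR n f +_) (sumR-neg n g))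

  sumR-from : ∀ n lo (f : ℕ → R) →
              sumR (n Nat.∸ lo) (λ k → f (lo Nat.+ k)) ≡ sumR n (λ l → if lo Nat.≤ᵇ l then f l else 0#)
  sumR-from n lo f with ℕₚ.≤-total lo n
  ... | inj₁ lo≤n = begin
    sumR (n Nat.∸ lo) (λ k → f (lo Nat.+ k))
      ≡⟨ sumR-cong (n Nat.∸ lo) (λ k _ → cong (λ b → if b then f (lo Nat.+ k) else 0#) (≤ᵇ-true (ℕₚ.m≤m+n lo k))) ⟨
    sumR (n Nat.∸ lo) (λ k → g (lo Nat.+ k))
      ≡⟨ +-identityˡ _ ⟨
    0# + sumR (n Nat.∸ lo) (λ k → g (lo Nat.+ k))
      ≡⟨ cong (_+ sumR (n Nat.∸ lo) (λ k → g (lo Nat.+ k)))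
              (sumR-zero lo (λ l l<lo → cong (λ b → if b then f l else 0#) (≤ᵇ-false l<lo))) ⟨
    sumR lo g + sumR (n Nat.∸ lo) (λ k → g (lo Nat.+ k))
      ≡⟨ sumR-split lo (n Nat.∸ lo) g ⟨
    sumR (lo Nat.+ (n Nat.∸ lo)) g
      ≡⟨ cong (λ m → sumR m g) (ℕₚ.m+[n∸m]≡n lo≤n) ⟩
    sumR n g ∎
    where
    g : ℕ → R
    g l = if lo Nat.≤ᵇ l then f l else 0#
  ... | inj₂ n≤lo = trans (cong (λ m → sumR m (λ k → f (lo Nat.+ k))) (ℕₚ.m≤n⇒m∸n≡0 n≤lo))
    (sym (sumR-zero n (λ l l<n → cong (λ b → if b then f l else 0#) (≤ᵇ-false (ℕₚ.<-≤-trans l<n n≤lo)))))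

  -- RHS writes Σ_{l=lo}^{n-1} as sumFromTo lo (n ∸ 1), guarded by n ≡ᵇ 0 because n ∸ 1 truncates at n = 0.
  sumFromTo-guarded : ∀ lo n (h : ℕ → R) →
    sumFromTo lo (n Nat.∸ 1) (λ l → if n Nat.≡ᵇ 0 then 0# else h l) ≡ sumR n (λ l → if lo Nat.≤ᵇ l then h l else 0#)
  sumFromTo-guarded lo zero    h = sumR-zero (1 Nat.∸ lo) (λ _ _ → refl)
  sumFromTo-guarded lo (suc n) h = sumR-from (suc n) lo h

  sumR-<ᵇ : ∀ B N (f : ℕ → R) → B Nat.≤ N → sumR N (λ i → if i Nat.<ᵇ B then f i else 0#) ≡ sumR B f
  sumR-<ᵇ B N f B≤N = begin
    sumR N g                                          ≡⟨ cong (λ m → sumR m g) (ℕₚ.m+[n∸m]≡n B≤N) ⟨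
    sumR (B Nat.+ (N Nat.∸ B)) g                      ≡⟨ sumR-split B (N Nat.∸ B) g ⟩
    sumR B g + sumR (N Nat.∸ B) (λ j → g (B Nat.+ j))
      ≡⟨ cong₂ _+_ (sumR-cong B (λ i i<B → cong (λ b → if b then f i else 0#) (≤ᵇ-true i<B)))
                   (sumR-zero (N Nat.∸ B) (λ j _ → cong (λ b → if b then f (B Nat.+ j) else 0#)
                                                        (≤ᵇ-false (s≤s (ℕₚ.m≤m+n B j))))) ⟩
    sumR B f + 0#                                     ≡⟨ +-identityʳ _ ⟩
    sumR B f                                          ∎
    where
    g : ℕ → R
    g i = if i Nat.<ᵇ B then f i else 0#

  binomial : ∀ y n → sumR (suc n) (λ i → fromℕ (n C i) * y ^ i) ≡ (1# + y) ^ n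
  binomial y zero    = trans (+-identityˡ _) (trans (*-identityʳ _) fromℕ-1)
  binomial y (suc n) = begin
    sumR (suc (suc n)) (term (suc n))
      ≡⟨ sumR-suc (suc n) (term (suc n)) ⟩
    term (suc n) 0 + sumR (suc n) (λ i → fromℕ (suc n C suc i) * y ^ suc i)
      ≡⟨ cong₂ _+_ (term-0 (suc n)) (sumR-cong (suc n) (λ i _ → pascal i)) ⟩
    1# + sumR (suc n) (λ i → y * term n i + term n (suc i))
      ≡⟨ cong (1# +_) (trans (sumR-+ (suc n) _ _) (cong (_+ sumR (suc n) (term n ∘ suc)) (sumR-*ˡ (suc n) y (term n)))) ⟩
    1# + (y * sumR (suc n) (term n) + sumR (suc n) (term n ∘ suc))
      ≡⟨ solve 3 (λ o A B → o :+ (A :+ B) := (o :+ B) :+ A) refl 1# _ _ ⟩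
    (1# + sumR (suc n) (term n ∘ suc)) + y * sumR (suc n) (term n)
      ≡⟨ cong₂ _+_ (trans (cong (_+ sumR (suc n) (term n ∘ suc)) (sym (term-0 n))) (sym (sumR-suc (suc n) (term n))))
                   (cong (y *_) (binomial y n)) ⟩
    (sumR (suc n) (term n) + term n (suc n)) + y * (1# + y) ^ n
      ≡⟨ cong₂ (λ S t → S + t + y * (1# + y) ^ n) (binomial y n)
               (trans (cong (λ c → fromℕ c * y ^ suc n) (k>n⇒nCk≡0 (ℕₚ.n<1+n n))) (zeroˡ _)) ⟩
    (1# + y) ^ n + 0# + y * (1# + y) ^ n
      ≡⟨ solve 2 (λ y P → P :+ con (ℤ.+ 0) :+ y :* P := (con (ℤ.+ 1) :+ y) :* P) refl y _ ⟩
    (1# + y) ^ suc n ∎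
    where
    term : ℕ → ℕ → R
    term m i = fromℕ (m C i) * y ^ i
    term-0 : ∀ m → term m 0 ≡ 1#
    term-0 m = trans (*-identityʳ _) fromℕ-1
    pascal : ∀ i → fromℕ (suc n C suc i) * y ^ suc i ≡ y * term n i + term n (suc i)
    pascal i = begin
      fromℕ (suc n C suc i) * (y * y ^ i)
        ≡⟨ cong (λ c → fromℕ c * (y * y ^ i)) (nCk+nC[k+1]≡[n+1]C[k+1] n i) ⟨
      fromℕ (n C i Nat.+ n C suc i) * (y * y ^ i)
        ≡⟨ cong (_* (y * y ^ i)) (fromℕ-+ (n C i) (n C suc i)) ⟩
      (fromℕ (n C i) + fromℕ (n C suc i)) * (y * y ^ i)
        ≡⟨ solve 4 (λ A B y Y → (A :+ B) :* (y :* Y) := y :* (A :* Y) :+ B :* (y :* Y)) refl _ _ y (y ^ i) ⟩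
      y * term n i + term n (suc i) ∎

  binomial-below : ∀ y n → sumR n (λ i → fromℕ (n C i) * y ^ i) ≡ (1# + y) ^ n - y ^ n
  binomial-below y n = begin
    sumR n term                           ≡⟨ solve 2 (λ S Y → S := (S :+ Y) :- Y) refl _ (y ^ n) ⟩
    (sumR n term + y ^ n) - y ^ n         ≡⟨ cong (λ t → (sumR n term + t) - y ^ n) top-term ⟨
    sumR (suc n) term - y ^ n             ≡⟨ cong (_- y ^ n) (binomial y n) ⟩
    (1# + y) ^ n - y ^ n                  ∎
    where
    term : ℕ → R
    term i = fromℕ (n C i) * y ^ i
    top-term : term n ≡ y ^ n
    top-term = trans (cong (λ c → fromℕ c * y ^ n) (nCn≡1 n)) (trans (cong (_* y ^ n) fromℕ-1) (*-identityˡ _))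

  -- The digit sums S and D

  fromℕ-value-map-suc : ∀ L e → fromℕ (value (map suc L)) ^ e ≡ fromℕ 2 ^ e * fromℕ (value L) ^ e
  fromℕ-value-map-suc L e = begin
    fromℕ (value (map suc L)) ^ e         ≡⟨ cong (λ v → fromℕ v ^ e) (value-map-suc L) ⟩
    fromℕ (2 Nat.* value L) ^ e           ≡⟨ cong (_^ e) (fromℕ-* 2 (value L)) ⟩
    (fromℕ 2 * fromℕ (value L)) ^ e       ≡⟨ ^-distrib-* (fromℕ 2) _ e ⟩
    fromℕ 2 ^ e * fromℕ (value L) ^ e     ∎

  S′ : R → ℕ → List ℕ → R
  S′ c i []          = 0#
  S′ c i (x ∷ [])    = 0#
  S′ c i (x ∷ y ∷ L) = 1# * c ^ x * fromℕ (value (y ∷ L)) ^ i + S′ c i (y ∷ L)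

  S≡S′ : ∀ b i m → S b 0 i m ≡ S′ (twoInv^ i * b) i (bits m)
  S≡S′ b i m = go (bits m)
    where
    go : ∀ L → sumR (length L Nat.∸ 1) (λ k → 1# * (twoInv^ i * b) ^ at L k * fromℕ (value (drop (suc k) L)) ^ i)
               ≡ S′ (twoInv^ i * b) i L
    go []          = refl
    go (x ∷ [])    = refl
    go (x ∷ y ∷ L) = trans (sumR-suc (length L) _) (cong (1# * (twoInv^ i * b) ^ x * fromℕ (value (y ∷ L)) ^ i +_) (go (y ∷ L)))

  S′-map-suc : ∀ c i L → S′ c i (map suc L) ≡ (c * fromℕ 2 ^ i) * S′ c i L
  S′-map-suc c i []          = sym (zeroʳ _)
  S′-map-suc c i (x ∷ [])    = sym (zeroʳ _)
  S′-map-suc c i (x ∷ y ∷ L) = begin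
    1# * (c * c ^ x) * fromℕ (value (map suc (y ∷ L))) ^ i + S′ c i (map suc (y ∷ L))
      ≡⟨ cong₂ (λ V S → 1# * (c * c ^ x) * V + S) (fromℕ-value-map-suc (y ∷ L) i) (S′-map-suc c i (y ∷ L)) ⟩
    1# * (c * c ^ x) * (fromℕ 2 ^ i * V) + (c * fromℕ 2 ^ i) * S′ c i (y ∷ L)
      ≡⟨ solve 5 (λ c X T V S → con (ℤ.+ 1) :* (c :* X) :* (T :* V) :+ (c :* T) :* S
                               := (c :* T) :* (con (ℤ.+ 1) :* X :* V :+ S)) refl c (c ^ x) (fromℕ 2 ^ i) V _ ⟩
    (c * fromℕ 2 ^ i) * S′ c i (x ∷ y ∷ L) ∎
    where
    V : R
    V = fromℕ (value (y ∷ L)) ^ i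

  S′-0∷ : ∀ c i L → L ≢ [] → S′ c i (0 ∷ L) ≡ fromℕ (value L) ^ i + S′ c i L
  S′-0∷ c i []      L≢[] = ⊥-elim (L≢[] refl)
  S′-0∷ c i (y ∷ L) _    =
    cong (_+ S′ c i (y ∷ L)) (trans (cong (_* fromℕ (value (y ∷ L)) ^ i) (*-identityˡ 1#)) (*-identityˡ _))

  S-double : ∀ b i k → S b 0 i (k Nat.+ k) ≡ b * S b 0 i k
  S-double b i k = begin
    S b 0 i (k Nat.+ k)                         ≡⟨ S≡S′ b i (k Nat.+ k) ⟩
    S′ c i (bits (k Nat.+ k))                   ≡⟨ cong (S′ c i) (bits-double k) ⟩
    S′ c i (map suc (bits k))                   ≡⟨ S′-map-suc c i (bits k) ⟩
    (c * fromℕ 2 ^ i) * S′ c i (bits k)         ≡⟨ cong₂ _*_ c2ⁱ≡b (sym (S≡S′ b i k)) ⟩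
    b * S b 0 i k                               ∎
    where
    c : R
    c = twoInv^ i * b
    c2ⁱ≡b : c * fromℕ 2 ^ i ≡ b
    c2ⁱ≡b = begin
      twoInv^ i * b * fromℕ 2 ^ i    ≡⟨ solve 3 (λ u b T → u :* b :* T := (u :* T) :* b) refl (twoInv^ i) b _ ⟩
      twoInv^ i * fromℕ 2 ^ i * b    ≡⟨ cong (_* b) (twoInv^-inverse i) ⟩
      1# * b                         ≡⟨ *-identityˡ b ⟩
      b                              ∎

  S-double+1 : ∀ b i k .{{_ : NonZero k}} →
               S b 0 i (suc (k Nat.+ k)) ≡ fromℕ (k Nat.+ k) ^ i + b * S b 0 i k
  S-double+1 b i k = begin
    S b 0 i (suc (k Nat.+ k))                        ≡⟨ S≡S′ b i (suc (k Nat.+ k)) ⟩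
    S′ c i (bits (suc (k Nat.+ k)))                  ≡⟨ cong (S′ c i) (bits-double+1 k) ⟩
    S′ c i (0 ∷ map suc (bits k))                    ≡⟨ cong (λ L → S′ c i (0 ∷ L)) (bits-double k) ⟨
    S′ c i (0 ∷ bits (k Nat.+ k))
      ≡⟨ S′-0∷ c i (bits (k Nat.+ k)) (bits-nonempty (k Nat.+ k) {{double≢0 k}}) ⟩
    fromℕ (value (bits (k Nat.+ k))) ^ i + S′ c i (bits (k Nat.+ k))
      ≡⟨ cong₂ (λ v S → fromℕ v ^ i + S) (value-bits (k Nat.+ k)) (sym (S≡S′ b i (k Nat.+ k))) ⟩
    fromℕ (k Nat.+ k) ^ i + S b 0 i (k Nat.+ k)      ≡⟨ cong (fromℕ (k Nat.+ k) ^ i +_) (S-double b i k) ⟩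
    fromℕ (k Nat.+ k) ^ i + b * S b 0 i k            ∎
    where
    c : R
    c = twoInv^ i * b

  D : ℕ → ℕ → R
  D e m = sumR (s m) (λ j → (fromℕ (M (suc j) m) ^ e) * fromℕ (q (suc j) m Nat.∸ q j m))

  D′ : ℕ → ℕ → List ℕ → R
  D′ e p []      = 0#
  D′ e p (x ∷ L) = fromℕ (value (x ∷ L)) ^ e * fromℕ (x Nat.∸ p) + D′ e x L

  D≡D′ : ∀ e m → D e m ≡ D′ e 0 (bits m)
  D≡D′ e m = trans (sumR-cong (s m) (λ j _ → cong (λ p → fromℕ (M (suc j) m) ^ e * fromℕ (q (suc j) m Nat.∸ p))
                                                   (q≡at j)))
                   (go 0 (bits m))
    where
    q≡at : ∀ j → q j m ≡ at (0 ∷ bits m) j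
    q≡at zero    = refl
    q≡at (suc j) = refl
    go : ∀ p L → sumR (length L) (λ j → fromℕ (value (drop j L)) ^ e * fromℕ (at L j Nat.∸ at (p ∷ L) j))
                 ≡ D′ e p L
    go p []      = refl
    go p (x ∷ L) = trans (sumR-suc (length L) _) (cong (fromℕ (value (x ∷ L)) ^ e * fromℕ (x Nat.∸ p) +_) (go x L))

  D′-map-suc : ∀ e p L → D′ e (suc p) (map suc L) ≡ fromℕ 2 ^ e * D′ e p L
  D′-map-suc e p []      = sym (zeroʳ _)
  D′-map-suc e p (x ∷ L) = begin
    fromℕ (value (map suc (x ∷ L))) ^ e * fromℕ (x Nat.∸ p) + D′ e (suc x) (map suc L)
      ≡⟨ cong₂ (λ V D → V * fromℕ (x Nat.∸ p) + D) (fromℕ-value-map-suc (x ∷ L) e) (D′-map-suc e x L) ⟩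
    fromℕ 2 ^ e * fromℕ (value (x ∷ L)) ^ e * fromℕ (x Nat.∸ p) + fromℕ 2 ^ e * D′ e x L
      ≡⟨ solve 4 (λ T V X D → T :* V :* X :+ T :* D := T :* (V :* X :+ D)) refl _ _ _ _ ⟩
    fromℕ 2 ^ e * D′ e p (x ∷ L) ∎

  D′-0-map-suc : ∀ e L → L ≢ [] →
                 D′ e 0 (map suc L) ≡ fromℕ 2 ^ e * D′ e 0 L + fromℕ (value (map suc L)) ^ e
  D′-0-map-suc e []      L≢[] = ⊥-elim (L≢[] refl)
  D′-0-map-suc e (x ∷ L) _    = begin
    V′ * fromℕ (suc x) + D′ e (suc x) (map suc L)
      ≡⟨ cong (V′ * fromℕ (suc x) +_) (D′-map-suc e x L) ⟩
    V′ * (1# + fromℕ x) + fromℕ 2 ^ e * D′ e x L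
      ≡⟨ cong (λ W → W * (1# + fromℕ x) + fromℕ 2 ^ e * D′ e x L) (fromℕ-value-map-suc (x ∷ L) e) ⟩
    (2ᵉ * V) * (1# + fromℕ x) + 2ᵉ * D′ e x L
      ≡⟨ solve 4 (λ T V X D → (T :* V) :* (con (ℤ.+ 1) :+ X) :+ T :* D := T :* (V :* X :+ D) :+ T :* V)
                 refl 2ᵉ V (fromℕ x) (D′ e x L) ⟩
    2ᵉ * D′ e 0 (x ∷ L) + 2ᵉ * V
      ≡⟨ cong (2ᵉ * D′ e 0 (x ∷ L) +_) (fromℕ-value-map-suc (x ∷ L) e) ⟨
    2ᵉ * D′ e 0 (x ∷ L) + V′ ∎
    where
    2ᵉ V V′ : R
    2ᵉ = fromℕ 2 ^ e
    V = fromℕ (value (x ∷ L)) ^ e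
    V′ = fromℕ (value (map suc (x ∷ L))) ^ e

  D-double : ∀ e k .{{_ : NonZero k}} → D e (k Nat.+ k) ≡ fromℕ 2 ^ e * D e k + fromℕ (k Nat.+ k) ^ e
  D-double e k = begin
    D e (k Nat.+ k)                                   ≡⟨ D≡D′ e (k Nat.+ k) ⟩
    D′ e 0 (bits (k Nat.+ k))                         ≡⟨ cong (D′ e 0) (bits-double k) ⟩
    D′ e 0 (map suc (bits k))                         ≡⟨ D′-0-map-suc e (bits k) (bits-nonempty k) ⟩
    fromℕ 2 ^ e * D′ e 0 (bits k) + fromℕ (value (map suc (bits k))) ^ e
      ≡⟨ cong₂ (λ D v → fromℕ 2 ^ e * D + fromℕ v ^ e) (sym (D≡D′ e k)) value-double ⟩
    fromℕ 2 ^ e * D e k + fromℕ (k Nat.+ k) ^ e       ∎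
    where
    value-double : value (map suc (bits k)) ≡ k Nat.+ k
    value-double = trans (cong value (sym (bits-double k))) (value-bits (k Nat.+ k))

  D-double+1 : ∀ e k → D e (suc (k Nat.+ k)) ≡ D e (k Nat.+ k)
  D-double+1 e k = begin
    D e (suc (k Nat.+ k))                             ≡⟨ D≡D′ e (suc (k Nat.+ k)) ⟩
    D′ e 0 (bits (suc (k Nat.+ k)))                   ≡⟨ cong (D′ e 0) (bits-double+1 k) ⟩
    fromℕ (value (0 ∷ map suc (bits k))) ^ e * 0# + D′ e 0 (map suc (bits k))
      ≡⟨ trans (cong (_+ D′ e 0 (map suc (bits k))) (zeroʳ _)) (+-identityˡ _) ⟩
    D′ e 0 (map suc (bits k))                         ≡⟨ cong (D′ e 0) (bits-double k) ⟨
    D′ e 0 (bits (k Nat.+ k))                         ≡⟨ D≡D′ e (k Nat.+ k) ⟨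
    D e (k Nat.+ k)                                   ∎

  module BinaryRecurrence (a c : R) (u v : ℕ → R) where

    record Solution (f : ℕ → R) : Set where
      field
        at-1        : f 1 ≡ c
        at-double   : ∀ k .{{_ : NonZero k}} → f (k Nat.+ k) ≡ a * f k + u k
        at-double+1 : ∀ k .{{_ : NonZero k}} → f (suc (k Nat.+ k)) ≡ a * f k + v k

    solutions-agree : ∀ {f g} → Solution f → Solution g → ∀ m → 1 Nat.≤ m → f m ≡ g m
    solutions-agree {f} {g} f-sol g-sol = binary-induction (λ m → 1 Nat.≤ m → f m ≡ g m) (λ ()) double double+1
      where
      module f = Solution f-sol
      module g = Solution g-sol
      double : ∀ k → (1 Nat.≤ k → f k ≡ g k) → 1 Nat.≤ k Nat.+ k → f (k Nat.+ k) ≡ g (k Nat.+ k)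
      double (suc k) ih _ =
        trans (f.at-double (suc k)) (trans (cong (λ y → a * y + u (suc k)) (ih (s≤s z≤n))) (sym (g.at-double (suc k))))
      double+1 : ∀ k → (1 Nat.≤ k → f k ≡ g k) → 1 Nat.≤ suc (k Nat.+ k) → f (suc (k Nat.+ k)) ≡ g (suc (k Nat.+ k))
      double+1 zero    _  _ = trans f.at-1 (sym g.at-1)
      double+1 (suc k) ih _ =
        trans (f.at-double+1 (suc k)) (trans (cong (λ y → a * y + v (suc k)) (ih (s≤s z≤n))) (sym (g.at-double+1 (suc k))))

  module DoublingRecurrence (a : R) (r t : ℕ) where

    forcing : ℕ → ℕ → R
    forcing u v = fromℕ (u Nat.^ r Nat.* v Nat.^ t)

    forcing-even forcing-odd : ℕ → R
    forcing-even k = forcing (suc k) k - forcing k k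
    forcing-odd  k = forcing (suc k) (suc k) - forcing (suc k) k

    open BinaryRecurrence a 1# forcing-even forcing-odd public

    differences-solve : (x : ℕ → R) → x 1 ≡ 0# →
      (∀ n → 2 Nat.≤ n → x n ≡ a * x ⌈ n /2⌉ + a * x ⌊ n /2⌋ + forcing ⌈ n /2⌉ ⌊ n /2⌋) →
      Solution (λ m → x (suc m) - x m)
    differences-solve x x₁≡0 rec = record
      { at-1        = at-1
      ; at-double   = at-double
      ; at-double+1 = at-double+1
      }
      where
      rec-at : ∀ n {c f} → 2 Nat.≤ n → ⌈ n /2⌉ ≡ c → ⌊ n /2⌋ ≡ f → x n ≡ a * x c + a * x f + forcing c f
      rec-at n 2≤n refl refl = rec n 2≤n

      rec-double : ∀ k .{{_ : NonZero k}} → x (k Nat.+ k) ≡ a * x k + a * x k + forcing k k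
      rec-double k = rec-at (k Nat.+ k) (2≤double k) (sym (ℕₚ.n≡⌈n+n/2⌉ k)) (sym (ℕₚ.n≡⌊n+n/2⌋ k))

      rec-double+1 : ∀ k .{{_ : NonZero k}} → x (suc (k Nat.+ k)) ≡ a * x (suc k) + a * x k + forcing (suc k) k
      rec-double+1 k = rec-at (suc (k Nat.+ k)) (ℕₚ.m≤n⇒m≤1+n (2≤double k))
                              (cong suc (sym (ℕₚ.n≡⌊n+n/2⌋ k))) (sym (ℕₚ.n≡⌈n+n/2⌉ k))

      rec-double+2 : ∀ k → x (suc (suc (k Nat.+ k))) ≡ a * x (suc k) + a * x (suc k) + forcing (suc k) (suc k)
      rec-double+2 k = rec-at (suc (suc (k Nat.+ k))) (s≤s (s≤s z≤n))
                              (cong suc (sym (ℕₚ.n≡⌈n+n/2⌉ k))) (cong suc (sym (ℕₚ.n≡⌊n+n/2⌋ k)))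

      at-1 : x 2 - x 1 ≡ 1#
      at-1 = begin
        x 2 - x 1                                 ≡⟨ cong₂ _-_ (rec 2 ℕₚ.≤-refl) x₁≡0 ⟩
        a * x 1 + a * x 1 + forcing 1 1 - 0#      ≡⟨ cong (λ y → a * y + a * y + forcing 1 1 - 0#) x₁≡0 ⟩
        a * 0# + a * 0# + forcing 1 1 - 0#
          ≡⟨ solve 2 (λ a F → a :* con (ℤ.+ 0) :+ a :* con (ℤ.+ 0) :+ F :- con (ℤ.+ 0) := F) refl a (forcing 1 1) ⟩
        forcing 1 1
          ≡⟨ cong₂ (λ u v → fromℕ (u Nat.* v)) (ℕₚ.^-zeroˡ r) (ℕₚ.^-zeroˡ t) ⟩
        fromℕ 1                                   ≡⟨ fromℕ-1 ⟩
        1#                                        ∎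

      at-double : ∀ k .{{_ : NonZero k}} →
                  x (suc (k Nat.+ k)) - x (k Nat.+ k) ≡ a * (x (suc k) - x k) + forcing-even k
      at-double k = trans (cong₂ _-_ (rec-double+1 k) (rec-double k))
        (solve 5 (λ a X₁ X₀ F₁ F₀ → a :* X₁ :+ a :* X₀ :+ F₁ :- (a :* X₀ :+ a :* X₀ :+ F₀)
                                  := a :* (X₁ :- X₀) :+ (F₁ :- F₀))
               refl a (x (suc k)) (x k) (forcing (suc k) k) (forcing k k))

      at-double+1 : ∀ k .{{_ : NonZero k}} →
                    x (suc (suc (k Nat.+ k))) - x (suc (k Nat.+ k))
                    ≡ a * (x (suc k) - x k) + forcing-odd k
      at-double+1 k = trans (cong₂ _-_ (rec-double+2 k) (rec-double+1 k))
        (solve 5 (λ a X₁ X₀ F₂ F₁ → a :* X₁ :+ a :* X₁ :+ F₂ :- (a :* X₁ :+ a :* X₀ :+ F₁)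
                                  := a :* (X₁ :- X₀) :+ (F₂ :- F₁))
               refl a (x (suc k)) (x k) (forcing (suc k) (suc k)) (forcing (suc k) k))

  module ExcludingEll (a : R) (t : ℕ) where

    ell-unique : ∀ {l l′} → IsEll a t l → IsEll a t l′ → l ≡ l′
    ell-unique ℓ≡l ℓ≡l′ = ℕₚ.+-cancelˡ-≡ t _ _ (2^-injective (fromℕ-injective _ _ (trans ℓ≡l (sym ℓ≡l′))))

    unlessEll-cong : ∀ l {v w} → (¬ IsEll a t l → v ≡ w) → unlessEll a t l v ≡ unlessEll a t l w
    unlessEll-cong l v≡w with isEll? a t l
    ... | yes _  = refl
    ... | no ¬ℓ = v≡w ¬ℓ

    unlessEll-+ : ∀ l v w → unlessEll a t l (v + w) ≡ unlessEll a t l v + unlessEll a t l w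
    unlessEll-+ l v w with isEll? a t l
    ... | yes _ = sym (+-identityˡ 0#)
    ... | no  _ = refl

    unlessEll-* : ∀ l c v → unlessEll a t l (c * v) ≡ c * unlessEll a t l v
    unlessEll-* l c v with isEll? a t l
    ... | yes _ = sym (zeroʳ c)
    ... | no  _ = refl

    unlessEll-0 : ∀ l → unlessEll a t l 0# ≡ 0#
    unlessEll-0 l with isEll? a t l
    ... | yes _ = refl
    ... | no  _ = refl

    Σ≠ℓ : ℕ → (ℕ → R) → R
    Σ≠ℓ n f = sumR n (λ l → unlessEll a t l (f l))

    Σ≠ℓ-cong : ∀ n {f g} → (∀ l → ¬ IsEll a t l → f l ≡ g l) → Σ≠ℓ n f ≡ Σ≠ℓ n g
    Σ≠ℓ-cong n f≗g = sumR-cong n (λ l _ → unlessEll-cong l (f≗g l))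

    Σ≠ℓ-+ : ∀ n f g → Σ≠ℓ n (λ l → f l + g l) ≡ Σ≠ℓ n f + Σ≠ℓ n g
    Σ≠ℓ-+ n f g = trans (sumR-cong n (λ l _ → unlessEll-+ l (f l) (g l))) (sumR-+ n _ _)

    Σ≠ℓ-*ˡ : ∀ n c f → Σ≠ℓ n (λ l → c * f l) ≡ c * Σ≠ℓ n f
    Σ≠ℓ-*ˡ n c f = trans (sumR-cong n (λ l _ → unlessEll-* l c (f l))) (sumR-*ˡ n c _)

    Σ≠ℓ+findEll : ∀ n f → Σ≠ℓ n f + findEll a t n f ≡ sumR n f
    Σ≠ℓ+findEll zero    f = +-identityʳ 0#
    Σ≠ℓ+findEll (suc n) f with isEll? a t n
    ... | yes ℓ≡n = begin
      Σ≠ℓ n f + 0# + f n   ≡⟨ cong (_+ f n) (+-identityʳ _) ⟩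
      Σ≠ℓ n f + f n        ≡⟨ cong (_+ f n) (sumR-cong n (λ l l<n → unlessEll-l≠n l l<n)) ⟩
      sumR n f + f n       ∎
      where
      unlessEll-l≠n : ∀ l → l Nat.< n → unlessEll a t l (f l) ≡ f l
      unlessEll-l≠n l l<n with isEll? a t l
      ... | yes ℓ≡l = ⊥-elim (ℕₚ.<-irrefl (ell-unique ℓ≡l ℓ≡n) l<n)
      ... | no  _   = refl
    ... | no  _ = trans (solve 3 (λ A B C → (A :+ B) :+ C := (A :+ C) :+ B) refl _ (f n) _) (cong (_+ f n) (Σ≠ℓ+findEll n f))

    findEll-linear : ∀ n c (g h w : ℕ → R) → (∀ ℓ → IsEll a t ℓ → g ℓ ≡ c * h ℓ + w ℓ) →
                     findEll a t n g ≡ c * findEll a t n h + findEll a t n w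
    findEll-linear zero    c g h w _ = sym (trans (cong (_+ 0#) (zeroʳ c)) (+-identityʳ 0#))
    findEll-linear (suc n) c g h w g≡ch+w with isEll? a t n
    ... | yes ℓ≡n = g≡ch+w n ℓ≡n
    ... | no  _   = findEll-linear n c g h w g≡ch+w

    findEll-zero : ∀ n (g : ℕ → R) → (∀ ℓ → g ℓ ≡ 0#) → findEll a t n g ≡ 0#
    findEll-zero zero    g _   = refl
    findEll-zero (suc n) g g≗0 with isEll? a t n
    ... | yes _ = g≗0 n
    ... | no  _ = findEll-zero n g g≗0

    sumR-unlessEll : ∀ n l (f : ℕ → R) → sumR n (λ i → unlessEll a t l (f i)) ≡ unlessEll a t l (sumR n f)
    sumR-unlessEll n l f with isEll? a t l
    ... | yes _ = sumR-zero n (λ _ _ → refl)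
    ... | no  _ = refl

  module ClosedForm (a : R) (a≢0 : a ≢ 0#) (r t : ℕ) where
    open DoublingRecurrence a r t
    open ExcludingEll a t

    b : ℕ → R
    b l = fromℕ (r C l) * inv (fromℕ (2 Nat.^ (t Nat.+ l)) - a)

    b-spec : ∀ l → ¬ IsEll a t l → b l * (fromℕ (2 Nat.^ (t Nat.+ l)) - a) ≡ fromℕ (r C l)
    b-spec l ¬ℓ = begin
      fromℕ (r C l) * inv X * X     ≡⟨ *-assoc _ _ _ ⟩
      fromℕ (r C l) * (inv X * X)   ≡⟨ cong (fromℕ (r C l) *_) (inv-inverseˡ X (¬ℓ ∘ x-y≡0⇒x≡y)) ⟩
      fromℕ (r C l) * 1#            ≡⟨ *-identityʳ _ ⟩
      fromℕ (r C l)                 ∎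
      where
      X : R
      X = fromℕ (2 Nat.^ (t Nat.+ l)) - a

    Σ₁-odd-increment γ-contribution : ℕ → R
    Σ₁-odd-increment k = Σ≠ℓ r (λ l → b l * (fromℕ (suc (k Nat.+ k)) ^ (t Nat.+ l) - a * fromℕ k ^ (t Nat.+ l)))
    γ-contribution   k = Σ≠ℓ r (λ l → b l * (fromℕ (suc (k Nat.+ k)) ^ (t Nat.+ l) - fromℕ (k Nat.+ k) ^ (t Nat.+ l)))

    binomialTerm : ℕ → ℕ → R
    binomialTerm k l = fromℕ (r C l) * fromℕ k ^ (t Nat.+ l)

    fromℕ-forcing : ∀ u v → forcing u v ≡ fromℕ u ^ r * fromℕ v ^ t
    fromℕ-forcing u v = trans (fromℕ-* (u Nat.^ r) (v Nat.^ t)) (cong₂ _*_ (fromℕ-^ u r) (fromℕ-^ v t))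

    sum-binomialTerm : ∀ k → sumR r (binomialTerm k) ≡ forcing-even k
    sum-binomialTerm k = begin
      sumR r (binomialTerm k)
        ≡⟨ sumR-cong r (λ l _ → trans (cong (fromℕ (r C l) *_) (^-homo-* K t l))
             (solve 3 (λ C Kᵗ Kˡ → C :* (Kᵗ :* Kˡ) := Kᵗ :* (C :* Kˡ)) refl _ (K ^ t) (K ^ l))) ⟩
      sumR r (λ l → K ^ t * (fromℕ (r C l) * K ^ l))
        ≡⟨ sumR-*ˡ r (K ^ t) _ ⟩
      K ^ t * sumR r (λ l → fromℕ (r C l) * K ^ l)
        ≡⟨ cong (K ^ t *_) (binomial-below K r) ⟩
      K ^ t * ((1# + K) ^ r - K ^ r)
        ≡⟨ solve 3 (λ Kᵗ K₁ʳ Kʳ → Kᵗ :* (K₁ʳ :- Kʳ) := K₁ʳ :* Kᵗ :- Kʳ :* Kᵗ)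
                   refl (K ^ t) ((1# + K) ^ r) (K ^ r) ⟩
      (1# + K) ^ r * K ^ t - K ^ r * K ^ t
        ≡⟨ cong₂ _-_ (fromℕ-forcing (suc k) k) (fromℕ-forcing k k) ⟨
      forcing (suc k) k - forcing k k ∎
      where
      K : R
      K = fromℕ k

    A : ℕ → R
    A m = a ^ topDigit m

    Σ₁ : ℕ → R
    Σ₁ m = Σ≠ℓ r (λ l → b l * (fromℕ m ^ (t Nat.+ l) - A m))

    α β γ coefficient : ℕ → R
    α i = twoInv^ i * fromℕ ((r Nat.+ t) C i)
    β i = twoInv^ i * fromℕ 2 * fromℕ (binomShift r i t)
    γ i = sumFromTo (suc i Nat.∸ t) (r Nat.∸ 1) (λ l → if r Nat.≡ᵇ 0 then 0# else unlessEll a t l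
            (fromℕ (r C l) * fromℕ ((t Nat.+ l) C i) * inv (fromℕ (2 Nat.^ (t Nat.+ l)) - a)))
    coefficient i = α i - β i - γ i

    Σ₂ : ℕ → R
    Σ₂ m = sumR (r Nat.+ t) (λ i → coefficient i * S a 0 i m)

    RHS-split : ∀ m → RHS a r t m ≡ A m + Σ₁ m + Σ₂ m + deltaTerm a r t m
    RHS-split m = cong₂ (λ u v → A m + u + v + deltaTerm a r t m)
                        (sumFromTo-guarded 0 r _) (sumFromTo-guarded 0 (r Nat.+ t) _)

    A-double : ∀ k .{{_ : NonZero k}} → A (k Nat.+ k) ≡ a * A k
    A-double k = cong (a ^_) (topDigit-double k)

    A-double+1 : ∀ k .{{_ : NonZero k}} → A (suc (k Nat.+ k)) ≡ a * A k
    A-double+1 k = cong (a ^_) (topDigit-double+1 k)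

    Σ₁-step : ∀ m m′ (P : ℕ → R) →
      (∀ l → ¬ IsEll a t l → b l * (fromℕ m ^ (t Nat.+ l) - A m) ≡ a * (b l * (fromℕ m′ ^ (t Nat.+ l) - A m′)) + P l) →
      Σ₁ m ≡ a * Σ₁ m′ + Σ≠ℓ r P
    Σ₁-step m m′ P pointwise =
      trans (Σ≠ℓ-cong r pointwise) (trans (Σ≠ℓ-+ r _ P) (cong (_+ Σ≠ℓ r P) (Σ≠ℓ-*ˡ r a _)))

    Σ₁-double : ∀ k .{{_ : NonZero k}} → Σ₁ (k Nat.+ k) ≡ a * Σ₁ k + Σ≠ℓ r (binomialTerm k)
    Σ₁-double k = Σ₁-step (k Nat.+ k) k (binomialTerm k) pointwise
      where
      pointwise : ∀ l → ¬ IsEll a t l →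
        b l * (fromℕ (k Nat.+ k) ^ (t Nat.+ l) - A (k Nat.+ k)) ≡ a * (b l * (fromℕ k ^ (t Nat.+ l) - A k)) + binomialTerm k l
      pointwise l ¬ℓ = begin
        b l * (fromℕ (k Nat.+ k) ^ (t Nat.+ l) - A (k Nat.+ k))
          ≡⟨ cong₂ (λ u v → b l * (u - v)) (fromℕ-double^ k (t Nat.+ l)) (A-double k) ⟩
        b l * (2ᵉ * Kᵉ - a * A k)
          ≡⟨ solve 5 (λ B T Kᵉ a A → B :* (T :* Kᵉ :- a :* A) := a :* (B :* (Kᵉ :- A)) :+ (B :* (T :- a)) :* Kᵉ)
                     refl (b l) 2ᵉ Kᵉ a (A k) ⟩
        a * (b l * (Kᵉ - A k)) + (b l * (2ᵉ - a)) * Kᵉ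
          ≡⟨ cong (λ c → a * (b l * (Kᵉ - A k)) + c * Kᵉ) (b-spec l ¬ℓ) ⟩
        a * (b l * (Kᵉ - A k)) + binomialTerm k l ∎
        where
        2ᵉ Kᵉ : R
        2ᵉ = fromℕ (2 Nat.^ (t Nat.+ l))
        Kᵉ = fromℕ k ^ (t Nat.+ l)

    Σ₁-double+1 : ∀ k .{{_ : NonZero k}} →
      Σ₁ (suc (k Nat.+ k)) ≡ a * Σ₁ k + Σ₁-odd-increment k
    Σ₁-double+1 k = Σ₁-step (suc (k Nat.+ k)) k _ pointwise
      where
      pointwise : ∀ l → ¬ IsEll a t l →
        b l * (fromℕ (suc (k Nat.+ k)) ^ (t Nat.+ l) - A (suc (k Nat.+ k)))
        ≡ a * (b l * (fromℕ k ^ (t Nat.+ l) - A k)) + b l * (fromℕ (suc (k Nat.+ k)) ^ (t Nat.+ l) - a * fromℕ k ^ (t Nat.+ l))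
      pointwise l _ = trans (cong (λ v → b l * (fromℕ (suc (k Nat.+ k)) ^ (t Nat.+ l) - v)) (A-double+1 k))
        (solve 5 (λ B X a A Kᵉ → B :* (X :- a :* A) := a :* (B :* (Kᵉ :- A)) :+ B :* (X :- a :* Kᵉ))
               refl (b l) (fromℕ (suc (k Nat.+ k)) ^ (t Nat.+ l)) a (A k) (fromℕ k ^ (t Nat.+ l)))

    Σ₂-double : ∀ k → Σ₂ (k Nat.+ k) ≡ a * Σ₂ k
    Σ₂-double k = trans (sumR-cong (r Nat.+ t) pointwise) (sumR-*ˡ (r Nat.+ t) a _)
      where
      pointwise : ∀ i → i Nat.< r Nat.+ t → coefficient i * S a 0 i (k Nat.+ k) ≡ a * (coefficient i * S a 0 i k)
      pointwise i _ = trans (cong (coefficient i *_) (S-double a i k))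
        (solve 3 (λ c a S → c :* (a :* S) := a :* (c :* S)) refl (coefficient i) a (S a 0 i k))

    Σ₂-double+1 : ∀ k .{{_ : NonZero k}} →
      Σ₂ (suc (k Nat.+ k)) ≡ sumR (r Nat.+ t) (λ i → coefficient i * fromℕ (k Nat.+ k) ^ i) + a * Σ₂ k
    Σ₂-double+1 k = trans (sumR-cong (r Nat.+ t) pointwise)
      (trans (sumR-+ (r Nat.+ t) _ _)
             (cong (sumR (r Nat.+ t) (λ i → coefficient i * fromℕ (k Nat.+ k) ^ i) +_) (sumR-*ˡ (r Nat.+ t) a _)))
      where
      pointwise : ∀ i → i Nat.< r Nat.+ t →
        coefficient i * S a 0 i (suc (k Nat.+ k)) ≡ coefficient i * fromℕ (k Nat.+ k) ^ i + a * (coefficient i * S a 0 i k)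
      pointwise i _ = trans (cong (coefficient i *_) (S-double+1 a i k))
        (solve 4 (λ c Y a S → c :* (Y :+ a :* S) := c :* Y :+ a :* (c :* S)) refl (coefficient i) _ a (S a 0 i k))

    deltaTerm-doubling : ∀ m k → (∀ e → D e m ≡ fromℕ 2 ^ e * D e k + fromℕ (k Nat.+ k) ^ e) →
      deltaTerm a r t m ≡ a * deltaTerm a r t k + findEll a t r (binomialTerm k)
    deltaTerm-doubling m k D-m = findEll-linear r a _ _ _ pointwise
      where
      pointwise : ∀ ℓ → IsEll a t ℓ →
        inv a * fromℕ (r C ℓ) * D (t Nat.+ ℓ) m ≡ a * (inv a * fromℕ (r C ℓ) * D (t Nat.+ ℓ) k) + binomialTerm k ℓ
      pointwise ℓ 2ᵉ≡a = begin
        inv a * Cℓ * D e m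
          ≡⟨ cong (inv a * Cℓ *_) (D-m e) ⟩
        inv a * Cℓ * (fromℕ 2 ^ e * D e k + fromℕ (k Nat.+ k) ^ e)
          ≡⟨ cong (λ v → inv a * Cℓ * (fromℕ 2 ^ e * D e k + v)) (fromℕ-double^ k e) ⟩
        inv a * Cℓ * (fromℕ 2 ^ e * D e k + fromℕ (2 Nat.^ e) * fromℕ k ^ e)
          ≡⟨ cong₂ (λ u v → inv a * Cℓ * (u * D e k + v * fromℕ k ^ e)) (trans (sym (fromℕ-^ 2 e)) 2ᵉ≡a) 2ᵉ≡a ⟩
        inv a * Cℓ * (a * D e k + a * fromℕ k ^ e)
          ≡⟨ solve 5 (λ a⁻¹ C a D Kᵉ → a⁻¹ :* C :* (a :* D :+ a :* Kᵉ)
                                     := a :* (a⁻¹ :* C :* D) :+ (a⁻¹ :* a) :* (C :* Kᵉ))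
                   refl (inv a) Cℓ a (D e k) (fromℕ k ^ e) ⟩
        a * (inv a * Cℓ * D e k) + (inv a * a) * binomialTerm k ℓ
          ≡⟨ cong (λ u → a * (inv a * Cℓ * D e k) + u * binomialTerm k ℓ) (inv-inverseˡ a a≢0) ⟩
        a * (inv a * Cℓ * D e k) + 1# * binomialTerm k ℓ
          ≡⟨ cong (a * (inv a * Cℓ * D e k) +_) (*-identityˡ _) ⟩
        a * (inv a * Cℓ * D e k) + binomialTerm k ℓ ∎
        where
        e : ℕ
        e = t Nat.+ ℓ
        Cℓ : R
        Cℓ = fromℕ (r C ℓ)

    twoInv^-double : ∀ k i → twoInv^ i * fromℕ (k Nat.+ k) ^ i ≡ fromℕ k ^ i
    twoInv^-double k i = begin
      twoInv^ i * fromℕ (k Nat.+ k) ^ i            ≡⟨ cong (λ v → twoInv^ i * v ^ i) (fromℕ-double k) ⟩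
      twoInv^ i * (fromℕ 2 * fromℕ k) ^ i          ≡⟨ cong (twoInv^ i *_) (^-distrib-* (fromℕ 2) (fromℕ k) i) ⟩
      twoInv^ i * (fromℕ 2 ^ i * fromℕ k ^ i)      ≡⟨ *-assoc _ _ _ ⟨
      twoInv^ i * fromℕ 2 ^ i * fromℕ k ^ i        ≡⟨ cong (_* fromℕ k ^ i) (twoInv^-inverse i) ⟩
      1# * fromℕ k ^ i                             ≡⟨ *-identityˡ _ ⟩
      fromℕ k ^ i                                  ∎

    α-sum : ∀ k → sumR (r Nat.+ t) (λ i → α i * fromℕ (k Nat.+ k) ^ i) ≡ forcing (suc k) (suc k) - forcing k k
    α-sum k = begin
      sumR (r Nat.+ t) (λ i → α i * fromℕ (k Nat.+ k) ^ i)
        ≡⟨ sumR-cong (r Nat.+ t) (λ i _ → trans (*-assoc _ _ _) (trans (cong (twoInv^ i *_) (*-comm _ _))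
             (trans (sym (*-assoc _ _ _)) (trans (cong (_* fromℕ ((r Nat.+ t) C i)) (twoInv^-double k i)) (*-comm _ _))))) ⟩
      sumR (r Nat.+ t) (λ i → fromℕ ((r Nat.+ t) C i) * fromℕ k ^ i)
        ≡⟨ binomial-below (fromℕ k) (r Nat.+ t) ⟩
      fromℕ (suc k) ^ (r Nat.+ t) - fromℕ k ^ (r Nat.+ t)
        ≡⟨ cong₂ _-_ (forcing-diagonal (suc k)) (forcing-diagonal k) ⟨
      forcing (suc k) (suc k) - forcing k k ∎
      where
      forcing-diagonal : ∀ u → forcing u u ≡ fromℕ u ^ (r Nat.+ t)
      forcing-diagonal u = trans (fromℕ-forcing u u) (sym (^-homo-* (fromℕ u) r t))

    binomShift-sum : ∀ k → sumR (r Nat.+ t) (λ i → fromℕ (binomShift r i t) * fromℕ k ^ i) ≡ sumR r (binomialTerm k)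
    binomShift-sum k = begin
      sumR (r Nat.+ t) f                        ≡⟨ cong (λ n → sumR n f) (ℕₚ.+-comm r t) ⟩
      sumR (t Nat.+ r) f                        ≡⟨ sumR-split t r f ⟩
      sumR t f + sumR r (λ j → f (t Nat.+ j))
        ≡⟨ cong₂ _+_ (sumR-zero t below-t) (sumR-cong r (λ j _ → from-t j)) ⟩
      0# + sumR r (binomialTerm k)              ≡⟨ +-identityˡ _ ⟩
      sumR r (binomialTerm k)                   ∎
      where
      f : ℕ → R
      f i = fromℕ (binomShift r i t) * fromℕ k ^ i
      from-t : ∀ j → f (t Nat.+ j) ≡ binomialTerm k j
      from-t j = cong₂ (λ u v → fromℕ (if u then 0 else r C v) * fromℕ k ^ (t Nat.+ j))
                       (≤ᵇ-false (s≤s (ℕₚ.m≤m+n t j))) (ℕₚ.m+n∸m≡n t j)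
      below-t : ∀ i → i Nat.< t → f i ≡ 0#
      below-t i i<t = trans (cong (λ u → fromℕ (if u then 0 else r C (i Nat.∸ t)) * fromℕ k ^ i) (≤ᵇ-true i<t)) (zeroˡ _)

    β-sum : ∀ k → sumR (r Nat.+ t) (λ i → β i * fromℕ (k Nat.+ k) ^ i) ≡ fromℕ 2 * sumR r (binomialTerm k)
    β-sum k = begin
      sumR (r Nat.+ t) (λ i → β i * fromℕ (k Nat.+ k) ^ i)
        ≡⟨ sumR-cong (r Nat.+ t) (λ i _ → trans
             (solve 4 (λ u c B Y → u :* c :* B :* Y := c :* (B :* (u :* Y))) refl (twoInv^ i) (fromℕ 2) _ _)
             (cong (λ v → fromℕ 2 * (fromℕ (binomShift r i t) * v)) (twoInv^-double k i))) ⟩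
      sumR (r Nat.+ t) (λ i → fromℕ 2 * (fromℕ (binomShift r i t) * fromℕ k ^ i))
        ≡⟨ sumR-*ˡ (r Nat.+ t) (fromℕ 2) _ ⟩
      fromℕ 2 * sumR (r Nat.+ t) (λ i → fromℕ (binomShift r i t) * fromℕ k ^ i)
        ≡⟨ cong (fromℕ 2 *_) (binomShift-sum k) ⟩
      fromℕ 2 * sumR r (binomialTerm k) ∎

    -- Exchange the two sums: l ≥ i + 1 - t is the same as i < t + l.
    γ-sum : ∀ k → sumR (r Nat.+ t) (λ i → γ i * fromℕ (k Nat.+ k) ^ i)
                ≡ γ-contribution k
    γ-sum k = begin
      sumR (r Nat.+ t) (λ i → γ i * Y ^ i)
        ≡⟨ sumR-cong (r Nat.+ t) (λ i _ → trans (cong (_* Y ^ i) (sumFromTo-guarded (suc i Nat.∸ t) r (h i)))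
             (trans (*-comm _ _) (sym (sumR-*ˡ r (Y ^ i) _)))) ⟩
      sumR (r Nat.+ t) (λ i → sumR r (λ l → Y ^ i * (if suc i Nat.∸ t Nat.≤ᵇ l then h i l else 0#)))
        ≡⟨ sumR-cong (r Nat.+ t) (λ i _ → sumR-cong r (λ l _ → γ-term i l)) ⟩
      sumR (r Nat.+ t) (λ i → sumR r (λ l → unlessEll a t l (b l * truncated l i)))
        ≡⟨ sumR-comm (r Nat.+ t) r _ ⟩
      sumR r (λ l → sumR (r Nat.+ t) (λ i → unlessEll a t l (b l * truncated l i)))
        ≡⟨ sumR-cong r (λ l l<r → trans (sumR-unlessEll (r Nat.+ t) l _) (cong (unlessEll a t l) (inner l l<r))) ⟩
      Σ≠ℓ r (λ l → b l * ((1# + Y) ^ (t Nat.+ l) - Y ^ (t Nat.+ l))) ∎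
      where
      Y : R
      Y = fromℕ (k Nat.+ k)
      h : ℕ → ℕ → R
      h i l = unlessEll a t l (fromℕ (r C l) * fromℕ ((t Nat.+ l) C i) * inv (fromℕ (2 Nat.^ (t Nat.+ l)) - a))
      truncated : ℕ → ℕ → R
      truncated l i = if i Nat.<ᵇ t Nat.+ l then fromℕ ((t Nat.+ l) C i) * Y ^ i else 0#
      γ-term : ∀ i l → Y ^ i * (if suc i Nat.∸ t Nat.≤ᵇ l then h i l else 0#) ≡ unlessEll a t l (b l * truncated l i)
      γ-term i l rewrite ∸-≤ᵇ (suc i) t l with i Nat.<ᵇ t Nat.+ l
      ... | false = trans (zeroʳ _) (sym (trans (cong (unlessEll a t l) (zeroʳ _)) (unlessEll-0 l)))
      ... | true  = trans (sym (unlessEll-* l (Y ^ i) _)) (cong (unlessEll a t l)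
            (solve 4 (λ Y C C′ I → Y :* (C :* C′ :* I) := (C :* I) :* (C′ :* Y)) refl (Y ^ i) _ _ _))
      inner : ∀ l → l Nat.< r → sumR (r Nat.+ t) (λ i → b l * truncated l i) ≡ b l * ((1# + Y) ^ (t Nat.+ l) - Y ^ (t Nat.+ l))
      inner l l<r = begin
        sumR (r Nat.+ t) (λ i → b l * truncated l i)   ≡⟨ sumR-*ˡ (r Nat.+ t) (b l) _ ⟩
        b l * sumR (r Nat.+ t) (truncated l)            ≡⟨ cong (b l *_) (sumR-<ᵇ (t Nat.+ l) (r Nat.+ t) _ t+l≤r+t) ⟩
        b l * sumR (t Nat.+ l) (λ i → fromℕ ((t Nat.+ l) C i) * Y ^ i)
          ≡⟨ cong (b l *_) (binomial-below Y (t Nat.+ l)) ⟩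
        b l * ((1# + Y) ^ (t Nat.+ l) - Y ^ (t Nat.+ l)) ∎
        where
        t+l≤r+t : t Nat.+ l Nat.≤ r Nat.+ t
        t+l≤r+t = ℕₚ.≤-trans (ℕₚ.+-monoʳ-≤ t (ℕₚ.<⇒≤ l<r)) (ℕₚ.≤-reflexive (ℕₚ.+-comm t r))

    coefficient-sum : ∀ k → sumR (r Nat.+ t) (λ i → coefficient i * fromℕ (k Nat.+ k) ^ i)
      ≡ (forcing (suc k) (suc k) - forcing k k) - fromℕ 2 * sumR r (binomialTerm k)
        - γ-contribution k
    coefficient-sum k = begin
      sumR (r Nat.+ t) (λ i → coefficient i * Y ^ i)
        ≡⟨ sumR-cong (r Nat.+ t) (λ i _ →
             solve 4 (λ A B C Y → (A :- B :- C) :* Y := A :* Y :- B :* Y :- C :* Y) refl (α i) (β i) (γ i) (Y ^ i)) ⟩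
      sumR (r Nat.+ t) (λ i → α i * Y ^ i - β i * Y ^ i - γ i * Y ^ i)
        ≡⟨ trans (sumR-− (r Nat.+ t) _ _) (cong (_- sumR (r Nat.+ t) (λ i → γ i * Y ^ i)) (sumR-− (r Nat.+ t) _ _)) ⟩
      sumR (r Nat.+ t) (λ i → α i * Y ^ i) - sumR (r Nat.+ t) (λ i → β i * Y ^ i) - sumR (r Nat.+ t) (λ i → γ i * Y ^ i)
        ≡⟨ cong₂ _-_ (cong₂ _-_ (α-sum k) (β-sum k)) (γ-sum k) ⟩
      _ ∎
      where
      Y : R
      Y = fromℕ (k Nat.+ k)

    Σ≠ℓ-double+1-split : ∀ k →
      Σ₁-odd-increment k
      ≡ γ-contribution k + Σ≠ℓ r (binomialTerm k)
    Σ≠ℓ-double+1-split k = trans (Σ≠ℓ-cong r pointwise) (Σ≠ℓ-+ r _ _)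
      where
      pointwise : ∀ l → ¬ IsEll a t l →
        b l * (fromℕ (suc (k Nat.+ k)) ^ (t Nat.+ l) - a * fromℕ k ^ (t Nat.+ l))
        ≡ b l * (fromℕ (suc (k Nat.+ k)) ^ (t Nat.+ l) - fromℕ (k Nat.+ k) ^ (t Nat.+ l)) + binomialTerm k l
      pointwise l ¬ℓ = begin
        b l * (X - a * Kᵉ)
          ≡⟨ solve 5 (λ B X a Kᵉ T → B :* (X :- a :* Kᵉ) := B :* (X :- T :* Kᵉ) :+ (B :* (T :- a)) :* Kᵉ)
                   refl (b l) X a Kᵉ (fromℕ (2 Nat.^ (t Nat.+ l))) ⟩
        b l * (X - fromℕ (2 Nat.^ (t Nat.+ l)) * Kᵉ) + (b l * (fromℕ (2 Nat.^ (t Nat.+ l)) - a)) * Kᵉ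
          ≡⟨ cong₂ (λ u v → b l * (X - u) + v * Kᵉ) (sym (fromℕ-double^ k (t Nat.+ l))) (b-spec l ¬ℓ) ⟩
        b l * (X - fromℕ (k Nat.+ k) ^ (t Nat.+ l)) + binomialTerm k l ∎
        where
        X Kᵉ : R
        X = fromℕ (suc (k Nat.+ k)) ^ (t Nat.+ l)
        Kᵉ = fromℕ k ^ (t Nat.+ l)

    RHS-double : ∀ k .{{_ : NonZero k}} → RHS a r t (k Nat.+ k) ≡ a * RHS a r t k + forcing-even k
    RHS-double k = begin
      RHS a r t (k Nat.+ k)
        ≡⟨ RHS-split (k Nat.+ k) ⟩
      A (k Nat.+ k) + Σ₁ (k Nat.+ k) + Σ₂ (k Nat.+ k) + deltaTerm a r t (k Nat.+ k)
        ≡⟨ cong₂ _+_ (cong₂ _+_ (cong₂ _+_ (A-double k) (Σ₁-double k)) (Σ₂-double k))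
                     (deltaTerm-doubling (k Nat.+ k) k (λ e → D-double e k)) ⟩
      a * A k + (a * Σ₁ k + E) + a * Σ₂ k + (a * deltaTerm a r t k + Fℓ)
        ≡⟨ solve 7 (λ a A S₁ S₂ Δ E F → a :* A :+ (a :* S₁ :+ E) :+ a :* S₂ :+ (a :* Δ :+ F)
                                        := a :* (A :+ S₁ :+ S₂ :+ Δ) :+ (E :+ F))
                 refl a (A k) (Σ₁ k) (Σ₂ k) (deltaTerm a r t k) E Fℓ ⟩
      a * (A k + Σ₁ k + Σ₂ k + deltaTerm a r t k) + (E + Fℓ)
        ≡⟨ cong₂ (λ u v → a * u + v) (sym (RHS-split k)) (trans (Σ≠ℓ+findEll r (binomialTerm k)) (sum-binomialTerm k)) ⟩
      a * RHS a r t k + forcing-even k ∎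
      where
      E Fℓ : R
      E = Σ≠ℓ r (binomialTerm k)
      Fℓ = findEll a t r (binomialTerm k)

    RHS-double+1 : ∀ k .{{_ : NonZero k}} →
      RHS a r t (suc (k Nat.+ k)) ≡ a * RHS a r t k + forcing-odd k
    RHS-double+1 k = begin
      RHS a r t (suc (k Nat.+ k))
        ≡⟨ RHS-split (suc (k Nat.+ k)) ⟩
      A (suc (k Nat.+ k)) + Σ₁ (suc (k Nat.+ k)) + Σ₂ (suc (k Nat.+ k)) + deltaTerm a r t (suc (k Nat.+ k))
        ≡⟨ cong₂ _+_ (cong₂ _+_ (cong₂ _+_ (A-double+1 k) (Σ₁-double+1 k)) (Σ₂-double+1 k))
                     (deltaTerm-doubling (suc (k Nat.+ k)) k (λ e → trans (D-double+1 e k) (D-double e k))) ⟩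
      a * A k + (a * Σ₁ k + Σ₁-odd-increment k) + (sumR (r Nat.+ t) (λ i → coefficient i * fromℕ (k Nat.+ k) ^ i) + a * Σ₂ k)
        + (a * deltaTerm a r t k + Fℓ)
        ≡⟨ cong₂ (λ u v → a * A k + (a * Σ₁ k + u) + (v + a * Σ₂ k) + (a * deltaTerm a r t k + Fℓ))
                 (Σ≠ℓ-double+1-split k) (coefficient-sum k) ⟩
      a * A k + (a * Σ₁ k + (W + E)) + (P - fromℕ 2 * G - W + a * Σ₂ k) + (a * deltaTerm a r t k + Fℓ)
        ≡⟨ cong (λ c → a * A k + (a * Σ₁ k + (W + E)) + (P - c * G - W + a * Σ₂ k) + (a * deltaTerm a r t k + Fℓ))
                fromℕ-2 ⟩
      a * A k + (a * Σ₁ k + (W + E)) + (P - (1# + 1#) * G - W + a * Σ₂ k) + (a * deltaTerm a r t k + Fℓ)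
        ≡⟨ solve 10 (λ a A S₁ S₂ Δ E F W P G → a :* A :+ (a :* S₁ :+ (W :+ E)) :+ (P :- con (ℤ.+ 2) :* G :- W :+ a :* S₂)
                                             :+ (a :* Δ :+ F)
                                             := a :* (A :+ S₁ :+ S₂ :+ Δ) :+ (P :- con (ℤ.+ 2) :* G) :+ (E :+ F))
                 refl a (A k) (Σ₁ k) (Σ₂ k) (deltaTerm a r t k) E Fℓ W P G ⟩
      a * (A k + Σ₁ k + Σ₂ k + deltaTerm a r t k) + (P - (1# + 1#) * G) + (E + Fℓ)
        ≡⟨ cong₂ (λ u v → a * u + (P - (1# + 1#) * G) + v) (sym (RHS-split k)) (Σ≠ℓ+findEll r (binomialTerm k)) ⟩
      a * RHS a r t k + (P - (1# + 1#) * G) + G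
        ≡⟨ cong (λ g → a * RHS a r t k + (P - (1# + 1#) * g) + g) (sum-binomialTerm k) ⟩
      a * RHS a r t k + (P - (1# + 1#) * (F₁₀ - F₀₀)) + (F₁₀ - F₀₀)
        ≡⟨ solve 4 (λ X F₁₁ F₁₀ F₀₀ → X :+ ((F₁₁ :- F₀₀) :- con (ℤ.+ 2) :* (F₁₀ :- F₀₀)) :+ (F₁₀ :- F₀₀)
                                    := X :+ (F₁₁ :- F₁₀))
                 refl (a * RHS a r t k) (forcing (suc k) (suc k)) F₁₀ F₀₀ ⟩
      a * RHS a r t k + forcing-odd k ∎
      where
      E Fℓ G P W F₁₀ F₀₀ : R
      W = γ-contribution k
      E = Σ≠ℓ r (binomialTerm k)
      Fℓ = findEll a t r (binomialTerm k)
      G = sumR r (binomialTerm k)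
      F₁₀ = forcing (suc k) k
      F₀₀ = forcing k k
      P = forcing (suc k) (suc k) - F₀₀

    RHS-1 : RHS a r t 1 ≡ 1#
    RHS-1 = begin
      RHS a r t 1                                   ≡⟨ RHS-split 1 ⟩
      1# + Σ₁ 1 + Σ₂ 1 + deltaTerm a r t 1          ≡⟨ cong₂ (λ u v → 1# + u + v + deltaTerm a r t 1) Σ₁-1 Σ₂-1 ⟩
      1# + 0# + 0# + deltaTerm a r t 1              ≡⟨ cong (1# + 0# + 0# +_) Δ-1 ⟩
      1# + 0# + 0# + 0#                             ≡⟨ solve 0 (con (ℤ.+ 1) :+ con (ℤ.+ 0) :+ con (ℤ.+ 0) :+ con (ℤ.+ 0)
                                                                := con (ℤ.+ 1)) refl ⟩
      1#                                            ∎
      where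
      Σ₁-1 : Σ₁ 1 ≡ 0#
      Σ₁-1 = sumR-zero r (λ l _ → trans (cong (unlessEll a t l) (trans (cong (λ u → b l * (u - 1#))
               (trans (cong (_^ (t Nat.+ l)) fromℕ-1) (1^n≡1 (t Nat.+ l)))) (trans (cong (b l *_) (-‿inverseʳ 1#)) (zeroʳ _))))
             (unlessEll-0 l))
      Σ₂-1 : Σ₂ 1 ≡ 0#
      Σ₂-1 = sumR-zero (r Nat.+ t) (λ i _ → zeroʳ _)
      Δ-1 : deltaTerm a r t 1 ≡ 0#
      Δ-1 = findEll-zero r _ (λ ℓ → trans (cong (inv a * fromℕ (r C ℓ) *_) (trans (+-identityˡ _) (zeroʳ _))) (zeroʳ _))

    RHS-solves : Solution (RHS a r t)
    RHS-solves = record { at-1 = RHS-1 ; at-double = RHS-double ; at-double+1 = RHS-double+1 }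

open Nat using (_≤_; _∸_; _*_; _^_)

proposition1 : (F : RealField) →
    (a : RealField.R F) → a ≢ RealField.0# F →
    (r t : ℕ) →
    (x : ℕ → RealField.R F) →
    x 1 ≡ RealField.0# F →
    (∀ n → 2 ≤ n →
      x n ≡ RealField._+_ F
              (RealField._+_ F (RealField._*_ F a (x ⌈ n /2⌉))
                               (RealField._*_ F a (x ⌊ n /2⌋)))
              (Paper.fromℕ F (⌈ n /2⌉ ^ r * ⌊ n /2⌋ ^ t))) →
    ∀ n → 2 ≤ n →
      RealField._-_ F (x n) (x (n ∸ 1)) ≡ Paper.RHS F a r t (n ∸ 1)
proposition1 F a a≢0 r t x x₁≡0 rec (suc m) (s≤s 1≤m) =
  solutions-agree (differences-solve x x₁≡0 rec) RHS-solves m 1≤m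
  where
  open Reals F
  open DoublingRecurrence a r t
  open ClosedForm a a≢0 r t
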